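{- Let $q$ be a prime power and $e,d$ integers with $e>d>0$. Let $g\in\mathbb{F}_q[T]$ be monic of degree $e$ with factorization pattern $(\lambda_1,\ldots,\lambda_e)$ and let $k$ be the least index with $\lambda_k>0$. For $0\le j\le d$ let $B_j$ be the set of monic $f\in\mathbb{F}_q[T]$ of degree $d$ with $\deg\gcd(g,f)=j$. Then $$\sum_{i=k+1}^d\left|\bigcup_{j=i}^dB_j\right|\le\sum_{i=k+1}^d(i-k)\,q^{d-i}\sum_{\substack{h_k\le\lambda_k,\ldots,\,h_i\le\lambda_i\\ k\,h_k+\cdots+i\,h_i=i}}\binom{\lambda_k}{h_k}\cdots\binom{\lambda_i}{h_i},$$ where the inner sum runs over tuples $(h_k,\ldots,h_i)$ of nonnegative integers.
   Context: $g$ has factorization pattern $(\lambda_1,\ldots,\lambda_e)$ if $g$ has exactly $\lambda_i$ monic irreducible factors of degree $i$ in $\mathbb{F}_q[T]$, counted with multiplicity, for $1\le i\le e$. -}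

module Defs where

open import Level using (0ℓ)
open import Data.Nat using (ℕ; zero; suc; _+_; _*_; _∸_; _^_; _≤_; _<_)
open import Data.Nat.Primality using (Prime)
open import Data.Nat.Combinatorics using (_C_)
open import Data.Fin using (Fin)
open import Data.Bool using (Bool; true; false; if_then_else_)
open import Data.List using (List; []; _∷_; map; concatMap; foldr; upTo; _++_; length; filter)
open import Data.Vec using (Vec; toList)
open import Data.Product using (Σ; ∃; ∃-syntax; _×_; _,_; proj₁)
open import Relation.Binary.PropositionalEquality using (_≡_; _≢_)
open import Relation.Nullary.Decidable using (⌊_⌋)
open import Algebra.Structures using (IsCommutativeRing)
open import Function.Bundles using (_⇔_)
open import Data.Nat using (_≟_)
open import Data.Nat.ListAction using (sum)

IsPrimePower : ℕ → Set
IsPrimePower q = ∃[ p ] ∃[ m ] (Prime p × q ≡ p ^ suc m)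

-- A field structure on the finite set Fin q (i.e. a model of 𝔽_q:
-- every field with q elements is isomorphic to one of these).
record FiniteField (q : ℕ) : Set where
  field
    _+F_ : Fin q → Fin q → Fin q
    _*F_ : Fin q → Fin q → Fin q
    -F_  : Fin q → Fin q
    0F   : Fin q
    1F   : Fin q
    isCommutativeRing : IsCommutativeRing _≡_ _+F_ _*F_ -F_ 0F 1F
    0≢1  : 0F ≢ 1F
    inverse : ∀ x → x ≢ 0F → ∃[ y ] (x *F y ≡ 1F)

module Poly {q : ℕ} (F : FiniteField q) where
  open FiniteField F

  -- polynomials as coefficient lists, lowest degree first
  addP : List (Fin q) → List (Fin q) → List (Fin q)
  addP [] ys = ys
  addP (x ∷ xs) [] = x ∷ xs
  addP (x ∷ xs) (y ∷ ys) = (x +F y) ∷ addP xs ys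

  mulP : List (Fin q) → List (Fin q) → List (Fin q)
  mulP [] ys = []
  mulP (x ∷ xs) ys = addP (map (x *F_) ys) (0F ∷ mulP xs ys)

  -- a monic polynomial: its degree n and its n lower coefficients
  -- (the leading coefficient 1 is implicit)
  Monic : Set
  Monic = Σ ℕ (Vec (Fin q))

  deg : Monic → ℕ
  deg = proj₁

  coeffs : Monic → List (Fin q)
  coeffs (n , v) = toList v ++ (1F ∷ [])

  _∣M_ : Monic → Monic → Set
  h ∣M g = ∃[ u ] (mulP (coeffs h) (coeffs u) ≡ coeffs g)

  Irreducible : Monic → Set
  Irreducible p = (1 ≤ deg p) ×
    (∀ a b → mulP (coeffs a) (coeffs b) ≡ coeffs p → (deg a ≡ 0) Data.Sum.⊎ (deg b ≡ 0))
    where import Data.Sum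

  productM : List Monic → List (Fin q)
  productM = foldr (λ p acc → mulP (coeffs p) acc) (1F ∷ [])

  countDeg : ℕ → List Monic → ℕ
  countDeg i ps = length (filter (λ p → deg p ≟ i) ps)

  -- g has factorization pattern (λ₁,…,λₑ), e = deg g, λ given as ℕ → ℕ
  -- (only the values at 1..e are meaningful)
  HasPattern : Monic → (ℕ → ℕ) → Set
  HasPattern g λs = ∃[ ps ]
    ( (∀ p → p Data.List.Membership.Propositional.∈ ps → Irreducible p)
    × productM ps ≡ coeffs g
    × (∀ i → 1 ≤ i → i ≤ deg g → λs i ≡ countDeg i ps))
    where import Data.List.Membership.Propositional

  IsGcd : Monic → Monic → Monic → Set
  IsGcd D g f = D ∣M g × D ∣M f × (∀ c → c ∣M g → c ∣M f → c ∣M D)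

  DegGcd : Monic → Monic → ℕ → Set
  DegGcd g f j = ∃[ D ] (deg D ≡ j × IsGcd D g f)

allVecs : (q d : ℕ) → List (Vec (Fin q) d)
allVecs q zero = Vec.[] ∷ []
  where import Data.Vec as Vec
allVecs q (suc d) = concatMap (λ x → map (x Vec.∷_) (allVecs q d)) (Data.List.allFin q)
  where import Data.Vec as Vec

countTrue : {A : Set} → (A → Bool) → List A → ℕ
countTrue χ xs = length (filter (λ x → χ x Data.Bool.≟ true) xs)
  where import Data.Bool

HasCard : {q d : ℕ} → (Vec (Fin q) d → Set) → ℕ → Set
HasCard {q} {d} P n = Σ (Vec (Fin q) d → Bool) λ χ →
  (∀ v → (χ v ≡ true) ⇔ P v) × countTrue χ (allVecs q d) ≡ n

-- Σ_{i=a}^{b} f i   (empty if b < a)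
sumRange : ℕ → ℕ → (ℕ → ℕ) → ℕ
sumRange a b f = sum (map (λ t → f (a + t)) (upTo (suc b ∸ a)))

module Tuples (λs : ℕ → ℕ) where
  boxes : ℕ → ℕ → List (List ℕ)
  boxes j zero = [] ∷ []
  boxes j (suc len) = concatMap (λ h → map (h ∷_) (boxes (suc j) len)) (upTo (suc (λs j)))

  weight : ℕ → List ℕ → ℕ
  weight j [] = 0
  weight j (h ∷ hs) = j * h + weight (suc j) hs

  binomProd : ℕ → List ℕ → ℕ
  binomProd j [] = 1
  binomProd j (h ∷ hs) = (λs j C h) * binomProd (suc j) hs

  innerSum : ℕ → ℕ → ℕ
  innerSum k i = sum (map (λ hs → if ⌊ weight k hs ≟ i ⌋ then binomProd k hs else 0)
                          (boxes k (suc i ∸ k)))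

-- Write g = p₁ ⋯ p_r as a product of monic irreducibles. A common divisor D of g and a monic f of
-- degree d is, by unique factorisation, the product of a subfamily of the pᵢ, with h_t members of
-- degree t; as g has no irreducible factor of degree below k, only t ≥ k occur, and if deg D = j
-- then k h_k + ⋯ + j h_j = j. So for deg D = j there are at most Σ_{(h_t)} Π_t C(λ_t, h_t) choices
-- of D and q^{d−j} of the monic cofactor f / D, which bounds |B_j|; hence |⋃_{j≥i} B_j| is at most
-- the sum of these bounds over j ∈ [i, d], and summing over i ∈ [k+1, d] counts the bound for j
-- exactly j − k times. Unique factorisation follows from Euclid's lemma for irreducibles, which
-- is proved by long division in 𝔽_q[T].

module Submission where

open import Defs

open import Level using (0ℓ)
open import Algebra.Bundles using (CommutativeRing)
import Algebra.Properties.CommutativeSemigroup as CommutativeSemigroupProperties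
open import Data.Bool using (Bool; true; if_then_else_)
import Data.Bool as Bool
open import Data.Empty using (⊥-elim)
open import Data.Fin using (Fin)
import Data.Fin as Fin
open import Data.List
  using (List; []; _∷_; _∷ʳ_; map; length; _++_; replicate; concatMap; filter; allFin; upTo; applyUpTo; cartesianProductWith)
open import Data.List.Properties
  using (length-map; length-tabulate; length-++; length-++-sucʳ; map-++; length-replicate; map-∘; map-cong; map-cong-local; map-id)
open import Data.List.Membership.Propositional using (_∈_; find; lose)
open import Data.List.Membership.Propositional.Properties
  using (∈-∃++; ∈-++⁻; ∈-++⁺ˡ; ∈-++⁺ʳ; ∈-allFin; ∈-cartesianProductWith⁺; ∈-map⁺; ∈-map⁻;
         ∈-concatMap⁺; ∈-concatMap⁻; ∈-upTo⁺; ∈-filter⁻; ∈-filter⁺; ∈-length)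
open import Data.List.Relation.Unary.Any using (here; there)
import Data.List.Relation.Unary.All as All
open import Data.List.Relation.Unary.AllPairs using ([]; _∷_)
open import Data.List.Relation.Unary.Unique.Propositional using (Unique)
import Data.List.Relation.Unary.Unique.Propositional.Properties as Unique
open import Data.List.Relation.Binary.Sublist.Propositional using (_⊆_)
import Data.List.Relation.Binary.Sublist.Propositional as ⊆
import Data.List.Relation.Binary.Sublist.Setoid.Properties
open import Data.Nat using (ℕ; zero; suc; _+_; _*_; _∸_; _^_; _≤_; _<_; _>_; z≤n; s≤s; _≟_; _≤?_)
import Data.Nat.Properties as ℕ
open import Data.Nat.Induction using (<-wellFounded)
open import Data.Nat.ListAction using (sum)
open import Data.Product using (Σ; ∃-syntax; _×_; _,_; proj₁; proj₂)
import Data.Product as Product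
open import Data.Product.Properties using (,-injectiveʳ-UIP)
open import Data.Sum using (_⊎_; inj₁; inj₂; [_,_]′)
open import Data.Vec using (Vec)
import Data.Vec as Vec
import Data.Vec.Properties as Vec
open import Function using (id; _∘_)
open import Function.Bundles using (Equivalence)
open import Induction.WellFounded using (Acc; acc)
open import Relation.Binary.Bundles using (Setoid)
open import Relation.Binary.PropositionalEquality
import Relation.Binary.Reasoning.Setoid
open import Relation.Nullary using (¬_; Dec; yes; no; ¬?)
open import Relation.Nullary.Decidable using (⌊_⌋)
open import Relation.Unary using (Decidable)

module FieldProperties {q : ℕ} (F : FiniteField q) where
  open FiniteField F

  fieldRing : CommutativeRing 0ℓ 0ℓ
  fieldRing = record { isCommutativeRing = isCommutativeRing }

  open CommutativeRing fieldRing public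
    using (+-assoc; +-comm; +-identityˡ; +-identityʳ; -‿inverseʳ;
           *-assoc; *-comm; *-identityˡ; *-identityʳ; distribˡ; distribʳ; zeroˡ; zeroʳ)

  open import Algebra.Properties.CommutativeSemigroup (CommutativeRing.+-commutativeSemigroup fieldRing) public
    using () renaming (interchange to +-interchange)

  -0≡0 : -F 0F ≡ 0F
  -0≡0 = ε⁻¹≈ε
    where open import Algebra.Properties.Group (CommutativeRing.+-group fieldRing) using (ε⁻¹≈ε)

  infix 30 _⁻¹⟨_⟩
  _⁻¹⟨_⟩ : ∀ c → c ≢ 0F → Fin q
  c ⁻¹⟨ c≢0 ⟩ = proj₁ (inverse c c≢0)

  *-inverse-cancel : ∀ {c} (c≢0 : c ≢ 0F) x → c *F (c ⁻¹⟨ c≢0 ⟩ *F x) ≡ x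
  *-inverse-cancel {c} c≢0 x = begin
    c *F (c ⁻¹⟨ c≢0 ⟩ *F x)   ≡⟨ *-assoc c _ x ⟨
    (c *F c ⁻¹⟨ c≢0 ⟩) *F x   ≡⟨ cong (_*F x) (proj₂ (inverse c c≢0)) ⟩
    1F *F x                   ≡⟨ *-identityˡ x ⟩
    x                         ∎
    where open ≡-Reasoning

  *-≡0⇒≡0 : ∀ {c x} → c ≢ 0F → c *F x ≡ 0F → x ≡ 0F
  *-≡0⇒≡0 {c} {x} c≢0 cx≡0 = begin
    x                            ≡⟨ *-inverse-cancel c≢0 x ⟨
    c *F (c ⁻¹⟨ c≢0 ⟩ *F x)      ≡⟨ cong (c *F_) (*-comm _ x) ⟩
    c *F (x *F c ⁻¹⟨ c≢0 ⟩)      ≡⟨ *-assoc c x _ ⟨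
    (c *F x) *F c ⁻¹⟨ c≢0 ⟩      ≡⟨ cong (_*F _) cx≡0 ⟩
    0F *F c ⁻¹⟨ c≢0 ⟩            ≡⟨ zeroˡ _ ⟩
    0F                           ∎
    where open ≡-Reasoning

  1≢0 : 1F ≢ 0F
  1≢0 e = 0≢1 (sym e)

module PolynomialRing {q : ℕ} (F : FiniteField q) where
  open FiniteField F
  open FieldProperties F
  open Poly F public

  Pol : Set
  Pol = List (Fin q)

  infixl 6 _+ₚ_ _-ₚ_
  infixl 7 _*ₚ_ _·ₚ_
  infix 4 _≈ₚ_

  _+ₚ_ _*ₚ_ _-ₚ_ : Pol → Pol → Pol
  negₚ : Pol → Pol
  _+ₚ_ = addP
  _*ₚ_ = mulP
  negₚ = map -F_
  a -ₚ b = a +ₚ negₚ b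

  _·ₚ_ : Fin q → Pol → Pol
  c ·ₚ a = map (c *F_) a

  0ₚ 1ₚ : Pol
  0ₚ = []
  1ₚ = 1F ∷ []

  coeff : Pol → ℕ → Fin q
  coeff []       n       = 0F
  coeff (x ∷ xs) zero    = x
  coeff (x ∷ xs) (suc n) = coeff xs n

  -- Coefficient lists differing by trailing zeros denote the same polynomial.
  record _≈ₚ_ (a b : Pol) : Set where
    constructor mk≈ₚ
    field coeff-≡ : ∀ n → coeff a n ≡ coeff b n
  open _≈ₚ_ public

  ≈ₚ-refl : ∀ {a} → a ≈ₚ a
  ≈ₚ-refl = mk≈ₚ λ n → refl

  ≈ₚ-reflexive : ∀ {a b} → a ≡ b → a ≈ₚ b
  ≈ₚ-reflexive refl = ≈ₚ-refl

  ≈ₚ-sym : ∀ {a b} → a ≈ₚ b → b ≈ₚ a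
  ≈ₚ-sym e = mk≈ₚ λ n → sym (coeff-≡ e n)

  ≈ₚ-trans : ∀ {a b c} → a ≈ₚ b → b ≈ₚ c → a ≈ₚ c
  ≈ₚ-trans e f = mk≈ₚ λ n → trans (coeff-≡ e n) (coeff-≡ f n)

  ≈ₚ-setoid : Setoid 0ℓ 0ℓ
  ≈ₚ-setoid = record
    { Carrier = Pol ; _≈_ = _≈ₚ_
    ; isEquivalence = record { refl = ≈ₚ-refl ; sym = ≈ₚ-sym ; trans = ≈ₚ-trans } }

  ∷-cong : ∀ {x y a b} → x ≡ y → a ≈ₚ b → x ∷ a ≈ₚ y ∷ b
  ∷-cong e f = mk≈ₚ λ { zero → e ; (suc n) → coeff-≡ f n }

  ∷-congʳ : ∀ {x a b} → a ≈ₚ b → x ∷ a ≈ₚ x ∷ b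
  ∷-congʳ = ∷-cong refl

  ∷-injective : ∀ {x y a b} → x ∷ a ≈ₚ y ∷ b → x ≡ y × a ≈ₚ b
  ∷-injective e = coeff-≡ e 0 , mk≈ₚ λ n → coeff-≡ e (suc n)

  ∷-zero : ∀ {x a} → x ∷ a ≈ₚ 0ₚ → x ≡ 0F × a ≈ₚ 0ₚ
  ∷-zero e = coeff-≡ e 0 , mk≈ₚ λ n → coeff-≡ e (suc n)

  0∷0≈0 : 0F ∷ 0ₚ ≈ₚ 0ₚ
  0∷0≈0 = mk≈ₚ λ { zero → refl ; (suc n) → refl }

  coeff-+ₚ : ∀ a b n → coeff (a +ₚ b) n ≡ coeff a n +F coeff b n
  coeff-+ₚ []      b       n       = sym (+-identityˡ _)
  coeff-+ₚ (x ∷ a) []      zero    = sym (+-identityʳ x)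
  coeff-+ₚ (x ∷ a) []      (suc n) = sym (+-identityʳ _)
  coeff-+ₚ (x ∷ a) (y ∷ b) zero    = refl
  coeff-+ₚ (x ∷ a) (y ∷ b) (suc n) = coeff-+ₚ a b n

  coeff-·ₚ : ∀ c a n → coeff (c ·ₚ a) n ≡ c *F coeff a n
  coeff-·ₚ c []      n       = sym (zeroʳ c)
  coeff-·ₚ c (x ∷ a) zero    = refl
  coeff-·ₚ c (x ∷ a) (suc n) = coeff-·ₚ c a n

  coeff-negₚ : ∀ a n → coeff (negₚ a) n ≡ -F coeff a n
  coeff-negₚ []      n       = sym -0≡0
  coeff-negₚ (x ∷ a) zero    = refl
  coeff-negₚ (x ∷ a) (suc n) = coeff-negₚ a n

  module ≈ₚ-Reasoning = Relation.Binary.Reasoning.Setoid ≈ₚ-setoid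

  +ₚ-cong : ∀ {a a′ b b′} → a ≈ₚ a′ → b ≈ₚ b′ → a +ₚ b ≈ₚ a′ +ₚ b′
  +ₚ-cong {a} {a′} {b} {b′} e f = mk≈ₚ λ n → begin
    coeff (a +ₚ b) n             ≡⟨ coeff-+ₚ a b n ⟩
    coeff a n +F coeff b n       ≡⟨ cong₂ _+F_ (coeff-≡ e n) (coeff-≡ f n) ⟩
    coeff a′ n +F coeff b′ n     ≡⟨ coeff-+ₚ a′ b′ n ⟨
    coeff (a′ +ₚ b′) n           ∎
    where open ≡-Reasoning

  +ₚ-comm : ∀ a b → a +ₚ b ≈ₚ b +ₚ a
  +ₚ-comm a b = mk≈ₚ λ n →
    trans (coeff-+ₚ a b n) (trans (+-comm _ _) (sym (coeff-+ₚ b a n)))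

  +ₚ-assoc : ∀ a b c → a +ₚ b +ₚ c ≈ₚ a +ₚ (b +ₚ c)
  +ₚ-assoc a b c = mk≈ₚ λ n → begin
    coeff (a +ₚ b +ₚ c) n                        ≡⟨ coeff-+ₚ (a +ₚ b) c n ⟩
    coeff (a +ₚ b) n +F coeff c n                ≡⟨ cong (_+F coeff c n) (coeff-+ₚ a b n) ⟩
    (coeff a n +F coeff b n) +F coeff c n        ≡⟨ +-assoc _ _ _ ⟩
    coeff a n +F (coeff b n +F coeff c n)        ≡⟨ cong (coeff a n +F_) (coeff-+ₚ b c n) ⟨
    coeff a n +F coeff (b +ₚ c) n                ≡⟨ coeff-+ₚ a (b +ₚ c) n ⟨
    coeff (a +ₚ (b +ₚ c)) n                      ∎
    where open ≡-Reasoning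

  +ₚ-identityʳ-≡ : ∀ a → a +ₚ 0ₚ ≡ a
  +ₚ-identityʳ-≡ []      = refl
  +ₚ-identityʳ-≡ (x ∷ a) = refl

  +ₚ-identityʳ : ∀ a → a +ₚ 0ₚ ≈ₚ a
  +ₚ-identityʳ a = ≈ₚ-reflexive (+ₚ-identityʳ-≡ a)

  +ₚ-≈0ʳ : ∀ a {z} → z ≈ₚ 0ₚ → a +ₚ z ≈ₚ a
  +ₚ-≈0ʳ a z≈0 = ≈ₚ-trans (+ₚ-cong ≈ₚ-refl z≈0) (+ₚ-identityʳ a)

  negₚ-cong : ∀ {a b} → a ≈ₚ b → negₚ a ≈ₚ negₚ b
  negₚ-cong {a} {b} e = mk≈ₚ λ n →
    trans (coeff-negₚ a n) (trans (cong -F_ (coeff-≡ e n)) (sym (coeff-negₚ b n)))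

  -ₚ-inverseʳ : ∀ a → a -ₚ a ≈ₚ 0ₚ
  -ₚ-inverseʳ a = mk≈ₚ λ n →
    trans (coeff-+ₚ a (negₚ a) n) (trans (cong (coeff a n +F_) (coeff-negₚ a n)) (-‿inverseʳ _))

  ·ₚ-congʳ : ∀ c {a b} → a ≈ₚ b → c ·ₚ a ≈ₚ c ·ₚ b
  ·ₚ-congʳ c {a} {b} e = mk≈ₚ λ n →
    trans (coeff-·ₚ c a n) (trans (cong (c *F_) (coeff-≡ e n)) (sym (coeff-·ₚ c b n)))

  ·ₚ-zeroˡ : ∀ a → 0F ·ₚ a ≈ₚ 0ₚ
  ·ₚ-zeroˡ a = mk≈ₚ λ n → trans (coeff-·ₚ 0F a n) (zeroˡ _)

  ·ₚ-identityˡ : ∀ a → 1F ·ₚ a ≈ₚ a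
  ·ₚ-identityˡ a = mk≈ₚ λ n → trans (coeff-·ₚ 1F a n) (*-identityˡ _)

  ·ₚ-assoc : ∀ c d a → c ·ₚ (d ·ₚ a) ≈ₚ (c *F d) ·ₚ a
  ·ₚ-assoc c d a = mk≈ₚ λ n → begin
    coeff (c ·ₚ (d ·ₚ a)) n    ≡⟨ coeff-·ₚ c (d ·ₚ a) n ⟩
    c *F coeff (d ·ₚ a) n      ≡⟨ cong (c *F_) (coeff-·ₚ d a n) ⟩
    c *F (d *F coeff a n)      ≡⟨ *-assoc c d _ ⟨
    (c *F d) *F coeff a n      ≡⟨ coeff-·ₚ (c *F d) a n ⟨
    coeff ((c *F d) ·ₚ a) n    ∎
    where open ≡-Reasoning

  ·ₚ-distrib-+ₚ : ∀ c a b → c ·ₚ (a +ₚ b) ≈ₚ c ·ₚ a +ₚ c ·ₚ b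
  ·ₚ-distrib-+ₚ c a b = mk≈ₚ λ n → begin
    coeff (c ·ₚ (a +ₚ b)) n                        ≡⟨ coeff-·ₚ c (a +ₚ b) n ⟩
    c *F coeff (a +ₚ b) n                          ≡⟨ cong (c *F_) (coeff-+ₚ a b n) ⟩
    c *F (coeff a n +F coeff b n)                  ≡⟨ distribˡ c _ _ ⟩
    (c *F coeff a n) +F (c *F coeff b n)           ≡⟨ cong₂ _+F_ (coeff-·ₚ c a n) (coeff-·ₚ c b n) ⟨
    coeff (c ·ₚ a) n +F coeff (c ·ₚ b) n           ≡⟨ coeff-+ₚ (c ·ₚ a) (c ·ₚ b) n ⟨
    coeff (c ·ₚ a +ₚ c ·ₚ b) n                     ∎
    where open ≡-Reasoning

  ·ₚ-∷ : ∀ c a → 0F ∷ c ·ₚ a ≈ₚ c ·ₚ (0F ∷ a)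
  ·ₚ-∷ c a = ∷-cong (sym (zeroʳ c)) ≈ₚ-refl

  ∷-+ₚ : ∀ a b → 0F ∷ a +ₚ b ≈ₚ (0F ∷ a) +ₚ (0F ∷ b)
  ∷-+ₚ a b = ∷-cong (sym (+-identityˡ 0F)) ≈ₚ-refl

  +ₚ-interchange : ∀ a b c d → (a +ₚ b) +ₚ (c +ₚ d) ≈ₚ (a +ₚ c) +ₚ (b +ₚ d)
  +ₚ-interchange a b c d = mk≈ₚ λ n → begin
    coeff ((a +ₚ b) +ₚ (c +ₚ d)) n                          ≡⟨ coeff-+ₚ (a +ₚ b) (c +ₚ d) n ⟩
    coeff (a +ₚ b) n +F coeff (c +ₚ d) n                    ≡⟨ cong₂ _+F_ (coeff-+ₚ a b n) (coeff-+ₚ c d n) ⟩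
    (coeff a n +F coeff b n) +F (coeff c n +F coeff d n)    ≡⟨ +-interchange _ _ _ _ ⟩
    (coeff a n +F coeff c n) +F (coeff b n +F coeff d n)    ≡⟨ cong₂ _+F_ (coeff-+ₚ a c n) (coeff-+ₚ b d n) ⟨
    coeff (a +ₚ c) n +F coeff (b +ₚ d) n                    ≡⟨ coeff-+ₚ (a +ₚ c) (b +ₚ d) n ⟨
    coeff ((a +ₚ c) +ₚ (b +ₚ d)) n                          ∎
    where open ≡-Reasoning

  ·ₚ-distribʳ : ∀ c d a → (c +F d) ·ₚ a ≈ₚ c ·ₚ a +ₚ d ·ₚ a
  ·ₚ-distribʳ c d a = mk≈ₚ λ n → begin
    coeff ((c +F d) ·ₚ a) n                    ≡⟨ coeff-·ₚ (c +F d) a n ⟩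
    (c +F d) *F coeff a n                      ≡⟨ distribʳ (coeff a n) c d ⟩
    (c *F coeff a n) +F (d *F coeff a n)       ≡⟨ cong₂ _+F_ (coeff-·ₚ c a n) (coeff-·ₚ d a n) ⟨
    coeff (c ·ₚ a) n +F coeff (d ·ₚ a) n       ≡⟨ coeff-+ₚ (c ·ₚ a) (d ·ₚ a) n ⟨
    coeff (c ·ₚ a +ₚ d ·ₚ a) n                 ∎
    where open ≡-Reasoning

  *ₚ-zeroʳ : ∀ a → a *ₚ 0ₚ ≈ₚ 0ₚ
  *ₚ-zeroʳ []      = ≈ₚ-refl
  *ₚ-zeroʳ (x ∷ a) = ≈ₚ-trans (∷-congʳ (*ₚ-zeroʳ a)) 0∷0≈0

  *ₚ-zeroˡ : ∀ {a} b → a ≈ₚ 0ₚ → a *ₚ b ≈ₚ 0ₚ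
  *ₚ-zeroˡ {[]}    b e = ≈ₚ-refl
  *ₚ-zeroˡ {x ∷ a} b e with ∷-zero e
  ... | refl , a≈0 = ≈ₚ-trans (+ₚ-cong (·ₚ-zeroˡ b) (∷-congʳ (*ₚ-zeroˡ b a≈0))) 0∷0≈0

  *ₚ-congʳ : ∀ a {b b′} → b ≈ₚ b′ → a *ₚ b ≈ₚ a *ₚ b′
  *ₚ-congʳ []      e = ≈ₚ-refl
  *ₚ-congʳ (x ∷ a) e = +ₚ-cong (·ₚ-congʳ x e) (∷-congʳ (*ₚ-congʳ a e))

  *ₚ-congˡ : ∀ {a a′} b → a ≈ₚ a′ → a *ₚ b ≈ₚ a′ *ₚ b
  *ₚ-congˡ {[]}    b e = ≈ₚ-sym (*ₚ-zeroˡ b (≈ₚ-sym e))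
  *ₚ-congˡ {x ∷ a} {[]} b e = *ₚ-zeroˡ b e
  *ₚ-congˡ {x ∷ a} {x′ ∷ a′} b e with ∷-injective e
  ... | refl , a≈a′ = +ₚ-cong ≈ₚ-refl (∷-congʳ (*ₚ-congˡ b a≈a′))

  *ₚ-cong : ∀ {a a′ b b′} → a ≈ₚ a′ → b ≈ₚ b′ → a *ₚ b ≈ₚ a′ *ₚ b′
  *ₚ-cong {a′ = a′} {b = b} e f = ≈ₚ-trans (*ₚ-congˡ b e) (*ₚ-congʳ a′ f)

  *ₚ-distribʳ : ∀ c a b → (a +ₚ b) *ₚ c ≈ₚ a *ₚ c +ₚ b *ₚ c
  *ₚ-distribʳ c []      b       = ≈ₚ-refl
  *ₚ-distribʳ c (x ∷ a) []      = ≈ₚ-sym (+ₚ-identityʳ _)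
  *ₚ-distribʳ c (x ∷ a) (y ∷ b) = begin
    (x +F y) ·ₚ c +ₚ (0F ∷ (a +ₚ b) *ₚ c)
      ≈⟨ +ₚ-cong (·ₚ-distribʳ x y c) (≈ₚ-trans (∷-congʳ (*ₚ-distribʳ c a b)) (∷-+ₚ (a *ₚ c) (b *ₚ c))) ⟩
    (x ·ₚ c +ₚ y ·ₚ c) +ₚ ((0F ∷ a *ₚ c) +ₚ (0F ∷ b *ₚ c))
      ≈⟨ +ₚ-interchange (x ·ₚ c) (y ·ₚ c) (0F ∷ a *ₚ c) (0F ∷ b *ₚ c) ⟩
    (x ∷ a) *ₚ c +ₚ (y ∷ b) *ₚ c ∎
    where open ≈ₚ-Reasoning

  *ₚ-distribˡ : ∀ a b c → a *ₚ (b +ₚ c) ≈ₚ a *ₚ b +ₚ a *ₚ c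
  *ₚ-distribˡ []      b c = ≈ₚ-refl
  *ₚ-distribˡ (x ∷ a) b c = begin
    x ·ₚ (b +ₚ c) +ₚ (0F ∷ a *ₚ (b +ₚ c))
      ≈⟨ +ₚ-cong (·ₚ-distrib-+ₚ x b c) (≈ₚ-trans (∷-congʳ (*ₚ-distribˡ a b c)) (∷-+ₚ (a *ₚ b) (a *ₚ c))) ⟩
    (x ·ₚ b +ₚ x ·ₚ c) +ₚ ((0F ∷ a *ₚ b) +ₚ (0F ∷ a *ₚ c))
      ≈⟨ +ₚ-interchange (x ·ₚ b) (x ·ₚ c) (0F ∷ a *ₚ b) (0F ∷ a *ₚ c) ⟩
    (x ∷ a) *ₚ b +ₚ (x ∷ a) *ₚ c ∎
    where open ≈ₚ-Reasoning

  *ₚ-·ₚˡ : ∀ c a b → (c ·ₚ a) *ₚ b ≈ₚ c ·ₚ (a *ₚ b)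
  *ₚ-·ₚˡ c []      b = ≈ₚ-refl
  *ₚ-·ₚˡ c (x ∷ a) b = begin
    (c *F x) ·ₚ b +ₚ (0F ∷ (c ·ₚ a) *ₚ b)
      ≈⟨ +ₚ-cong (≈ₚ-sym (·ₚ-assoc c x b)) (≈ₚ-trans (∷-congʳ (*ₚ-·ₚˡ c a b)) (·ₚ-∷ c (a *ₚ b))) ⟩
    c ·ₚ (x ·ₚ b) +ₚ c ·ₚ (0F ∷ a *ₚ b)
      ≈⟨ ·ₚ-distrib-+ₚ c (x ·ₚ b) (0F ∷ a *ₚ b) ⟨
    c ·ₚ ((x ∷ a) *ₚ b) ∎
    where open ≈ₚ-Reasoning

  *ₚ-·ₚʳ : ∀ c a b → a *ₚ (c ·ₚ b) ≈ₚ c ·ₚ (a *ₚ b)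
  *ₚ-·ₚʳ c []      b = ≈ₚ-refl
  *ₚ-·ₚʳ c (x ∷ a) b = begin
    x ·ₚ (c ·ₚ b) +ₚ (0F ∷ a *ₚ (c ·ₚ b))
      ≈⟨ +ₚ-cong x·c·b≈c·x·b (≈ₚ-trans (∷-congʳ (*ₚ-·ₚʳ c a b)) (·ₚ-∷ c (a *ₚ b))) ⟩
    c ·ₚ (x ·ₚ b) +ₚ c ·ₚ (0F ∷ a *ₚ b)
      ≈⟨ ·ₚ-distrib-+ₚ c (x ·ₚ b) (0F ∷ a *ₚ b) ⟨
    c ·ₚ ((x ∷ a) *ₚ b) ∎
    where
    open ≈ₚ-Reasoning
    x·c·b≈c·x·b : x ·ₚ (c ·ₚ b) ≈ₚ c ·ₚ (x ·ₚ b)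
    x·c·b≈c·x·b = ≈ₚ-trans (·ₚ-assoc x c b)
      (≈ₚ-trans (≈ₚ-reflexive (cong (_·ₚ b) (*-comm x c))) (≈ₚ-sym (·ₚ-assoc c x b)))

  ·ₚ-≈0⇒≈0 : ∀ {c a} → c ≢ 0F → c ·ₚ a ≈ₚ 0ₚ → a ≈ₚ 0ₚ
  ·ₚ-≈0⇒≈0 {c} {a} c≢0 e = mk≈ₚ λ n → *-≡0⇒≡0 c≢0 (trans (sym (coeff-·ₚ c a n)) (coeff-≡ e n))

  *ₚ-·ₚ-swap : ∀ c a b → (c ·ₚ a) *ₚ b ≈ₚ a *ₚ (c ·ₚ b)
  *ₚ-·ₚ-swap c a b = ≈ₚ-trans (*ₚ-·ₚˡ c a b) (≈ₚ-sym (*ₚ-·ₚʳ c a b))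

  *ₚ-∷ˡ : ∀ a b → (0F ∷ a) *ₚ b ≈ₚ 0F ∷ a *ₚ b
  *ₚ-∷ˡ a b = +ₚ-cong (·ₚ-zeroˡ b) ≈ₚ-refl

  *ₚ-∷ʳ : ∀ a y b → a *ₚ (y ∷ b) ≈ₚ y ·ₚ a +ₚ (0F ∷ a *ₚ b)
  *ₚ-∷ʳ []      y b = ≈ₚ-sym 0∷0≈0
  *ₚ-∷ʳ (x ∷ a) y b = ∷-cong (trans (+-identityʳ _) (trans (*-comm x y) (sym (+-identityʳ _)))) (begin
    x ·ₚ b +ₚ a *ₚ (y ∷ b)              ≈⟨ +ₚ-cong ≈ₚ-refl (*ₚ-∷ʳ a y b) ⟩
    x ·ₚ b +ₚ (y ·ₚ a +ₚ (0F ∷ a *ₚ b)) ≈⟨ +ₚ-assoc (x ·ₚ b) (y ·ₚ a) (0F ∷ a *ₚ b) ⟨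
    x ·ₚ b +ₚ y ·ₚ a +ₚ (0F ∷ a *ₚ b)   ≈⟨ +ₚ-cong (+ₚ-comm (x ·ₚ b) (y ·ₚ a)) ≈ₚ-refl ⟩
    y ·ₚ a +ₚ x ·ₚ b +ₚ (0F ∷ a *ₚ b)   ≈⟨ +ₚ-assoc (y ·ₚ a) (x ·ₚ b) (0F ∷ a *ₚ b) ⟩
    y ·ₚ a +ₚ (x ∷ a) *ₚ b              ∎)
    where open ≈ₚ-Reasoning

  *ₚ-comm : ∀ a b → a *ₚ b ≈ₚ b *ₚ a
  *ₚ-comm []      b = ≈ₚ-sym (*ₚ-zeroʳ b)
  *ₚ-comm (x ∷ a) b = ≈ₚ-trans (+ₚ-cong ≈ₚ-refl (∷-congʳ (*ₚ-comm a b))) (≈ₚ-sym (*ₚ-∷ʳ b x a))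

  *ₚ-assoc : ∀ a b c → a *ₚ b *ₚ c ≈ₚ a *ₚ (b *ₚ c)
  *ₚ-assoc []      b c = ≈ₚ-refl
  *ₚ-assoc (x ∷ a) b c = ≈ₚ-trans (*ₚ-distribʳ c (x ·ₚ b) (0F ∷ a *ₚ b))
    (+ₚ-cong (*ₚ-·ₚˡ x b c) (≈ₚ-trans (*ₚ-∷ˡ (a *ₚ b) c) (∷-congʳ (*ₚ-assoc a b c))))

  *ₚ-identityˡ : ∀ a → 1ₚ *ₚ a ≈ₚ a
  *ₚ-identityˡ a = ≈ₚ-trans (+ₚ-cong (·ₚ-identityˡ a) 0∷0≈0) (+ₚ-identityʳ a)

  polyRing : CommutativeRing 0ℓ 0ℓ
  polyRing = record
    { Carrier = Pol ; _≈_ = _≈ₚ_ ; _+_ = _+ₚ_ ; _*_ = _*ₚ_ ; -_ = negₚ ; 0# = 0ₚ ; 1# = 1ₚ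
    ; isCommutativeRing = record
      { isRing = record
        { +-isAbelianGroup = record
          { isGroup = record
            { isMonoid = record
              { isSemigroup = record
                { isMagma = record
                  { isEquivalence = Setoid.isEquivalence ≈ₚ-setoid ; ∙-cong = +ₚ-cong }
                ; assoc = +ₚ-assoc }
              ; identity = (λ a → ≈ₚ-refl) , +ₚ-identityʳ }
            ; inverse = (λ a → ≈ₚ-trans (+ₚ-comm (negₚ a) a) (-ₚ-inverseʳ a)) , -ₚ-inverseʳ
            ; ⁻¹-cong = negₚ-cong }
          ; comm = +ₚ-comm }
        ; *-cong = *ₚ-cong
        ; *-assoc = *ₚ-assoc
        ; *-identity = *ₚ-identityˡ , λ a → ≈ₚ-trans (*ₚ-comm a 1ₚ) (*ₚ-identityˡ a)
        ; distrib = *ₚ-distribˡ , *ₚ-distribʳ }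
      ; *-comm = *ₚ-comm } }

  -ₚ-+ₚ-cancel : ∀ a b → a -ₚ b +ₚ b ≈ₚ a
  -ₚ-+ₚ-cancel a b = begin
    a -ₚ b +ₚ b           ≈⟨ +ₚ-assoc a (negₚ b) b ⟩
    a +ₚ (negₚ b +ₚ b)    ≈⟨ +ₚ-cong ≈ₚ-refl (≈ₚ-trans (+ₚ-comm (negₚ b) b) (-ₚ-inverseʳ b)) ⟩
    a +ₚ 0ₚ               ≈⟨ +ₚ-identityʳ a ⟩
    a                     ∎
    where open ≈ₚ-Reasoning

  open import Algebra.Properties.Ring (CommutativeRing.ring polyRing) public using (x[y-z]≈xy-xz; [y-z]x≈yx-zx)
  open import Algebra.Properties.Group (CommutativeRing.+-group polyRing) public using (x∙y⁻¹≈ε⇒x≈y; x≈y⇒x∙y⁻¹≈ε)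
  open import Algebra.Properties.AbelianGroup (CommutativeRing.+-abelianGroup polyRing) public using (xyx⁻¹≈y)

  +ₚ-move : ∀ {a b c} → a ≈ₚ b +ₚ c → c ≈ₚ a -ₚ b
  +ₚ-move {a} {b} {c} a≈b+c = begin
    c                  ≈⟨ xyx⁻¹≈y b c ⟨
    b +ₚ c -ₚ b        ≈⟨ +ₚ-cong (≈ₚ-sym a≈b+c) ≈ₚ-refl ⟩
    a -ₚ b             ∎
    where open ≈ₚ-Reasoning

  module +ₚ = CommutativeSemigroupProperties (CommutativeRing.+-commutativeSemigroup polyRing)
  module *ₚ = CommutativeSemigroupProperties (CommutativeRing.*-commutativeSemigroup polyRing)

module LeadingCoefficients {q : ℕ} (F : FiniteField q) where
  open FiniteField F
  open FieldProperties F
  open PolynomialRing F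

  coeff-beyond : ∀ a {m} → length a ≤ m → coeff a m ≡ 0F
  coeff-beyond []      _         = refl
  coeff-beyond (x ∷ a) (s≤s a≤m) = coeff-beyond a a≤m

  coeff-∷ʳ : ∀ xs c → coeff (xs ∷ʳ c) (length xs) ≡ c
  coeff-∷ʳ []       c = refl
  coeff-∷ʳ (x ∷ xs) c = coeff-∷ʳ xs c

  DegreeBelow : Pol → ℕ → Set
  DegreeBelow c n = ∀ m → n ≤ m → coeff c m ≡ 0F

  degreeBelow-length : ∀ a {n} → length a ≡ n → DegreeBelow a n
  degreeBelow-length a refl m = coeff-beyond a

  ≈ₚ-length-≡⇒≡ : ∀ a b → length a ≡ length b → a ≈ₚ b → a ≡ b
  ≈ₚ-length-≡⇒≡ []      []      _   _ = refl
  ≈ₚ-length-≡⇒≡ (x ∷ a) (y ∷ b) |a|≡|b| e with ∷-injective e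
  ... | x≡y , a≈b = cong₂ _∷_ x≡y (≈ₚ-length-≡⇒≡ a b (ℕ.suc-injective |a|≡|b|) a≈b)

  ∷ʳ≉0 : ∀ xs {b} → b ≢ 0F → ¬ (xs ∷ʳ b ≈ₚ 0ₚ)
  ∷ʳ≉0 xs b≢0 e = b≢0 (trans (sym (coeff-∷ʳ xs _)) (coeff-≡ e (length xs)))

  ∷ʳ-injective-≈ₚ : ∀ xs ys {a b} → a ≢ 0F → b ≢ 0F → xs ∷ʳ a ≈ₚ ys ∷ʳ b → xs ≡ ys × a ≡ b
  ∷ʳ-injective-≈ₚ []       []       a≢0 b≢0 e = refl , proj₁ (∷-injective e)
  ∷ʳ-injective-≈ₚ []       (y ∷ ys) a≢0 b≢0 e = ⊥-elim (∷ʳ≉0 ys b≢0 (≈ₚ-sym (proj₂ (∷-injective e))))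
  ∷ʳ-injective-≈ₚ (x ∷ xs) []       a≢0 b≢0 e = ⊥-elim (∷ʳ≉0 xs a≢0 (proj₂ (∷-injective e)))
  ∷ʳ-injective-≈ₚ (x ∷ xs) (y ∷ ys) a≢0 b≢0 e with ∷-injective e
  ... | x≡y , e′ = Product.map (cong₂ _∷_ x≡y) id (∷ʳ-injective-≈ₚ xs ys a≢0 b≢0 e′)

  record Nonzero (c : Pol) : Set where
    constructor nonzero
    field
      init          : Pol
      lead          : Fin q
      lead≢0        : lead ≢ 0F
      ≈init∷ʳlead   : c ≈ₚ init ∷ʳ lead
      |init|<|c|    : length init < length c

  zero-or-nonzero : ∀ c → c ≈ₚ 0ₚ ⊎ Nonzero c
  zero-or-nonzero []      = inj₁ ≈ₚ-refl
  zero-or-nonzero (x ∷ c) with zero-or-nonzero c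
  ... | inj₂ (nonzero ys b b≢0 c≈ |ys|<|c|) = inj₂ (nonzero (x ∷ ys) b b≢0 (∷-congʳ c≈) (s≤s |ys|<|c|))
  ... | inj₁ c≈0 with x Fin.≟ 0F
  ...   | yes x≡0 = inj₁ (≈ₚ-trans (∷-cong x≡0 c≈0) 0∷0≈0)
  ...   | no  x≢0 = inj₂ (nonzero [] x x≢0 (∷-congʳ c≈0) (s≤s z≤n))

  degreeBelow-·ₚ : ∀ c a {n} → DegreeBelow a n → DegreeBelow (c ·ₚ a) n
  degreeBelow-·ₚ c a a<n m n≤m = trans (coeff-·ₚ c a m) (trans (cong (c *F_) (a<n m n≤m)) (zeroʳ c))

  length-+ₚ : ∀ a b → length a ≤ length b → length (a +ₚ b) ≡ length b
  length-+ₚ []      b       _          = refl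
  length-+ₚ (x ∷ a) (y ∷ b) (s≤s a≤b) = cong suc (length-+ₚ a b a≤b)

  +ₚ-∷ʳ : ∀ a b c → length a ≤ length b → a +ₚ (b ∷ʳ c) ≡ (a +ₚ b) ∷ʳ c
  +ₚ-∷ʳ []      b       c _          = refl
  +ₚ-∷ʳ (x ∷ a) (y ∷ b) c (s≤s a≤b) = cong ((x +F y) ∷_) (+ₚ-∷ʳ a b c a≤b)

  *ₚ-∷ʳ-lead : ∀ xs a ys b → Σ Pol λ zs →
    length zs ≡ length xs + length ys × (xs ∷ʳ a) *ₚ (ys ∷ʳ b) ≈ₚ zs ∷ʳ (a *F b)
  *ₚ-∷ʳ-lead [] a ys b = a ·ₚ ys , length-map _ ys ,
    ≈ₚ-trans (+ₚ-cong ≈ₚ-refl 0∷0≈0) (≈ₚ-trans (+ₚ-identityʳ _) (≈ₚ-reflexive (map-++ (a *F_) ys (b ∷ []))))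
  *ₚ-∷ʳ-lead (x ∷ xs) a ys b with *ₚ-∷ʳ-lead xs a ys b
  ... | zs , |zs| , e = x ·ₚ (ys ∷ʳ b) +ₚ (0F ∷ zs) , |sum| ,
    ≈ₚ-trans (+ₚ-cong ≈ₚ-refl (∷-congʳ e)) (≈ₚ-reflexive (+ₚ-∷ʳ _ (0F ∷ zs) (a *F b) shorter))
    where
    |x·ys∷ʳb| : length (x ·ₚ (ys ∷ʳ b)) ≡ suc (length ys)
    |x·ys∷ʳb| = trans (length-map _ (ys ∷ʳ b)) (trans (length-++ ys) (ℕ.+-comm (length ys) 1))
    shorter : length (x ·ₚ (ys ∷ʳ b)) ≤ length (0F ∷ zs)
    shorter = subst₂ _≤_ (sym |x·ys∷ʳb|) (cong suc (sym |zs|)) (s≤s (ℕ.m≤n+m (length ys) (length xs)))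
    |sum| : length (x ·ₚ (ys ∷ʳ b) +ₚ (0F ∷ zs)) ≡ suc (length xs) + length ys
    |sum| = trans (length-+ₚ (x ·ₚ (ys ∷ʳ b)) (0F ∷ zs) shorter) (cong suc |zs|)

module MonicPolynomials {q : ℕ} (F : FiniteField q) where
  open FiniteField F
  open FieldProperties F
  open PolynomialRing F
  open LeadingCoefficients F

  MonicOfDegree : Pol → ℕ → Set
  MonicOfDegree c n = Σ Pol λ zs → length zs ≡ n × c ≈ₚ zs ∷ʳ 1F

  coeffs-monic : ∀ M → MonicOfDegree (coeffs M) (deg M)
  coeffs-monic (n , v) = Vec.toList v , Vec.length-toList v , ≈ₚ-refl

  fromLower : Pol → Monic
  fromLower zs = length zs , Vec.fromList zs

  coeffs-fromLower : ∀ zs → coeffs (fromLower zs) ≡ zs ∷ʳ 1F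
  coeffs-fromLower zs = cong (_∷ʳ 1F) (Vec.toList∘fromList zs)

  monicOfDegree-resp-≈ₚ : ∀ {a b n} → a ≈ₚ b → MonicOfDegree a n → MonicOfDegree b n
  monicOfDegree-resp-≈ₚ a≈b (zs , |zs| , a≈) = zs , |zs| , ≈ₚ-trans (≈ₚ-sym a≈b) a≈

  monicOfDegree-*ₚ : ∀ {a b m n} → MonicOfDegree a m → MonicOfDegree b n → MonicOfDegree (a *ₚ b) (m + n)
  monicOfDegree-*ₚ (xs , refl , a≈) (ys , refl , b≈) with *ₚ-∷ʳ-lead xs 1F ys 1F
  ... | zs , |zs| , e = zs , |zs| ,
    ≈ₚ-trans (*ₚ-cong a≈ b≈) (≈ₚ-trans e (≈ₚ-reflexive (cong (zs ∷ʳ_) (*-identityˡ 1F))))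

  monicOfDegree-injective : ∀ {c m n} → MonicOfDegree c m → MonicOfDegree c n → m ≡ n
  monicOfDegree-injective (xs , refl , c≈) (ys , refl , c≈′) =
    cong length (proj₁ (∷ʳ-injective-≈ₚ xs ys 1≢0 1≢0 (≈ₚ-trans (≈ₚ-sym c≈) c≈′)))

  coeffs-injective : ∀ A B → coeffs A ≈ₚ coeffs B → A ≡ B
  coeffs-injective (m , v) (n , w) e = lemma m≡n v w lower≡
    where
    lower≡ : Vec.toList v ≡ Vec.toList w
    lower≡ = proj₁ (∷ʳ-injective-≈ₚ (Vec.toList v) (Vec.toList w) 1≢0 1≢0 e)
    m≡n : m ≡ n
    m≡n = trans (sym (Vec.length-toList v)) (trans (cong length lower≡) (Vec.length-toList w))
    lemma : ∀ {m n} → m ≡ n → (v : Vec (Fin q) m) (w : Vec (Fin q) n) → Vec.toList v ≡ Vec.toList w →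
            _≡_ {A = Monic} (m , v) (n , w)
    lemma refl v w eq = cong (_ ,_) (trans (sym (Vec.cast-is-id refl v)) (Vec.toList-injective refl v w eq))

  coeffs≉0 : ∀ A → ¬ (coeffs A ≈ₚ 0ₚ)
  coeffs≉0 (n , v) = ∷ʳ≉0 (Vec.toList v) 1≢0

  deg-*ₚ : ∀ A B C → coeffs A *ₚ coeffs B ≈ₚ coeffs C → deg C ≡ deg A + deg B
  deg-*ₚ A B C e = monicOfDegree-injective (coeffs-monic C)
    (monicOfDegree-resp-≈ₚ e (monicOfDegree-*ₚ (coeffs-monic A) (coeffs-monic B)))

  productM-monic : ∀ ps → MonicOfDegree (productM ps) (sum (map deg ps))
  productM-monic []       = [] , refl , ≈ₚ-refl
  productM-monic (p ∷ ps) = monicOfDegree-*ₚ (coeffs-monic p) (productM-monic ps)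

  deg-productM : ∀ D ps → coeffs D ≈ₚ productM ps → deg D ≡ sum (map deg ps)
  deg-productM D ps D≈ = monicOfDegree-injective (coeffs-monic D) (monicOfDegree-resp-≈ₚ (≈ₚ-sym D≈) (productM-monic ps))

  length-coeffs : ∀ A → length (coeffs A) ≡ suc (deg A)
  length-coeffs (n , v) = trans (length-++ (Vec.toList v)) (trans (ℕ.+-comm _ 1) (cong suc (Vec.length-toList v)))

  length-*ₚ : ∀ a b {m n} → length a ≡ suc m → length b ≡ suc n → length (a *ₚ b) ≡ suc (m + n)
  length-*ₚ (x ∷ a) (y ∷ b) refl refl = go x a y b
    where
    go : ∀ x a y b → length ((x ∷ a) *ₚ (y ∷ b)) ≡ suc (length a + length b)
    go x []       y b = cong suc (trans (cong length (+ₚ-identityʳ-≡ (x ·ₚ b))) (length-map _ b))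
    go x (x′ ∷ a) y b = trans (length-+ₚ (x ·ₚ (y ∷ b)) (0F ∷ (x′ ∷ a) *ₚ (y ∷ b)) shorter)
        (cong suc (go x′ a y b))
      where
      shorter : length (x ·ₚ (y ∷ b)) ≤ suc (length ((x′ ∷ a) *ₚ (y ∷ b)))
      shorter = subst₂ _≤_ (sym (length-map _ (y ∷ b))) (sym (cong suc (go x′ a y b)))
                  (s≤s (ℕ.m≤n+m (length b) (suc (length a))))

  *ₚ-coeffs-≡ : ∀ A B C → coeffs A *ₚ coeffs B ≈ₚ coeffs C → coeffs A *ₚ coeffs B ≡ coeffs C
  *ₚ-coeffs-≡ A B C e = ≈ₚ-length-≡⇒≡ _ _ |AB|≡|C| e
    where
    |AB|≡|C| : length (coeffs A *ₚ coeffs B) ≡ length (coeffs C)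
    |AB|≡|C| = begin
      length (coeffs A *ₚ coeffs B) ≡⟨ length-*ₚ (coeffs A) (coeffs B) (length-coeffs A) (length-coeffs B) ⟩
      suc (deg A + deg B)           ≡⟨ cong suc (deg-*ₚ A B C e) ⟨
      suc (deg C)                   ≡⟨ length-coeffs C ⟨
      length (coeffs C)             ∎
      where open ≡-Reasoning

  vectorOfDegree : ∀ U {n} → deg U ≡ n → Σ (Vec (Fin q) n) λ w → coeffs (n , w) ≡ coeffs U
  vectorOfDegree (n , w) refl = w , refl

  deg≡0⇒coeffs≡1ₚ : ∀ A → deg A ≡ 0 → coeffs A ≡ 1ₚ
  deg≡0⇒coeffs≡1ₚ (zero , Vec.[]) refl = refl

  nonzero⇒lead·monic : ∀ {c} (nz : Nonzero c) → let open Nonzero nz in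
    Σ Monic λ Ĉ → deg Ĉ ≡ length init × c ≈ₚ lead ·ₚ coeffs Ĉ
  nonzero⇒lead·monic (nonzero init α α≢0 c≈ _) = fromLower (α⁻¹ ·ₚ init) , length-map _ init ,
    ≈ₚ-trans c≈ (≈ₚ-reflexive (begin
      init ∷ʳ α                                 ≡⟨ cong₂ _∷ʳ_ (sym α·α⁻¹·init≡init) (sym (*-identityʳ α)) ⟩
      α ·ₚ (α⁻¹ ·ₚ init) ∷ʳ (α *F 1F)           ≡⟨ map-++ (α *F_) (α⁻¹ ·ₚ init) (1F ∷ []) ⟨
      α ·ₚ ((α⁻¹ ·ₚ init) ∷ʳ 1F)                ≡⟨ cong (α ·ₚ_) (coeffs-fromLower (α⁻¹ ·ₚ init)) ⟨
      α ·ₚ coeffs (fromLower (α⁻¹ ·ₚ init))     ∎))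
    where
    open ≡-Reasoning
    α⁻¹ = α ⁻¹⟨ α≢0 ⟩
    α·α⁻¹·init≡init : α ·ₚ (α⁻¹ ·ₚ init) ≡ init
    α·α⁻¹·init≡init = trans (sym (map-∘ init)) (trans (map-cong (*-inverse-cancel α≢0) init) (map-id init))

module MonicDivision {q : ℕ} (F : FiniteField q) where
  open FiniteField F
  open FieldProperties F
  open PolynomialRing F
  open LeadingCoefficients F
  open MonicPolynomials F

  private
    replicate-0≈0 : ∀ n → replicate n 0F ≈ₚ 0ₚ
    replicate-0≈0 zero    = ≈ₚ-refl
    replicate-0≈0 (suc n) = ≈ₚ-trans (∷-congʳ (replicate-0≈0 n)) 0∷0≈0

    ∷ʳ-view : ∀ (W : Pol) {n} → length W ≡ suc n → Σ Pol λ I → Σ (Fin q) λ c → W ≡ I ∷ʳ c × length I ≡ n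
    ∷ʳ-view (w ∷ [])     {zero}  refl = [] , w , refl , refl
    ∷ʳ-view (w ∷ w′ ∷ W) {suc n} eq with ∷ʳ-view (w′ ∷ W) (ℕ.suc-injective eq)
    ... | I , c , W≡ , |I| = w ∷ I , c , cong (w ∷_) W≡ , cong suc |I|

    ∷-+ₚ-split : ∀ x a b → x ∷ a +ₚ b ≈ₚ (0F ∷ a) +ₚ (x ∷ b)
    ∷-+ₚ-split x a b = ∷-cong (sym (+-identityˡ x)) ≈ₚ-refl

  length-minus-·ₚ : ∀ I c V → length I ≡ length V → length (I -ₚ c ·ₚ V) ≡ length V
  length-minus-·ₚ I c V |I|≡|V| = trans (length-+ₚ I (negₚ (c ·ₚ V)) (ℕ.≤-reflexive (trans |I|≡|V| (sym |−cV|)))) |−cV|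
    where
    |−cV| : length (negₚ (c ·ₚ V)) ≡ length V
    |−cV| = trans (length-map _ (c ·ₚ V)) (length-map _ V)

  ∷ʳ-reduce : ∀ I c V → length I ≡ length V → I ∷ʳ c ≈ₚ (I -ₚ c ·ₚ V) +ₚ c ·ₚ (V ∷ʳ 1F)
  ∷ʳ-reduce I c V |I|≡|V| = ≈ₚ-reflexive (begin
    I ∷ʳ c                                  ≡⟨ cong₂ _∷ʳ_ I≡ (sym (*-identityʳ c)) ⟩
    ((I -ₚ c ·ₚ V) +ₚ c ·ₚ V) ∷ʳ (c *F 1F)  ≡⟨ +ₚ-∷ʳ (I -ₚ c ·ₚ V) (c ·ₚ V) (c *F 1F) (ℕ.≤-reflexive |I-cV|) ⟨
    (I -ₚ c ·ₚ V) +ₚ (c ·ₚ V ∷ʳ (c *F 1F))  ≡⟨ cong ((I -ₚ c ·ₚ V) +ₚ_) (map-++ (c *F_) V (1F ∷ [])) ⟨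
    (I -ₚ c ·ₚ V) +ₚ c ·ₚ (V ∷ʳ 1F)         ∎)
    where
    open ≡-Reasoning
    |I-cV| : length (I -ₚ c ·ₚ V) ≡ length (c ·ₚ V)
    |I-cV| = trans (length-minus-·ₚ I c V |I|≡|V|) (sym (length-map _ V))
    I≡ : I ≡ (I -ₚ c ·ₚ V) +ₚ c ·ₚ V
    I≡ = ≈ₚ-length-≡⇒≡ I _
      (sym (trans (length-+ₚ (I -ₚ c ·ₚ V) (c ·ₚ V) (ℕ.≤-reflexive |I-cV|)) (trans (length-map _ V) (sym |I|≡|V|))))
      (≈ₚ-sym (-ₚ-+ₚ-cancel I (c ·ₚ V)))

  divide : ∀ M a → Σ Pol λ Q → Σ Pol λ R → length R ≡ deg M × a ≈ₚ coeffs M *ₚ Q +ₚ R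
  divide M [] = [] , replicate (deg M) 0F , length-replicate (deg M) ,
    ≈ₚ-sym (≈ₚ-trans (+ₚ-cong (*ₚ-zeroʳ (coeffs M)) ≈ₚ-refl) (replicate-0≈0 (deg M)))
  divide M@(n , v) (x ∷ a) with divide M a
  ... | Q , R , |R| , a≈ with ∷ʳ-view (x ∷ R) (cong suc |R|)
  ...   | I , c , x∷R≡ , |I| = c ∷ Q , R′ , |R′| , (begin
    x ∷ a                                       ≈⟨ ∷-congʳ a≈ ⟩
    x ∷ coeffs M *ₚ Q +ₚ R                      ≈⟨ ∷-+ₚ-split x (coeffs M *ₚ Q) R ⟩
    (0F ∷ coeffs M *ₚ Q) +ₚ (x ∷ R)             ≈⟨ +ₚ-cong (≈ₚ-refl {0F ∷ coeffs M *ₚ Q}) (≈ₚ-trans (≈ₚ-reflexive x∷R≡) (∷ʳ-reduce I c V |I|≡|V|)) ⟩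
    (0F ∷ coeffs M *ₚ Q) +ₚ (R′ +ₚ c ·ₚ coeffs M) ≈⟨ +ₚ.x∙yz≈zx∙y (0F ∷ coeffs M *ₚ Q) R′ (c ·ₚ coeffs M) ⟩
    c ·ₚ coeffs M +ₚ (0F ∷ coeffs M *ₚ Q) +ₚ R′  ≈⟨ +ₚ-cong (≈ₚ-sym (*ₚ-∷ʳ (coeffs M) c Q)) ≈ₚ-refl ⟩
    coeffs M *ₚ (c ∷ Q) +ₚ R′                   ∎)
    where
    open ≈ₚ-Reasoning
    V = Vec.toList v
    |I|≡|V| : length I ≡ length V
    |I|≡|V| = trans |I| (sym (Vec.length-toList v))
    R′ = I -ₚ c ·ₚ V
    |R′| : length R′ ≡ n
    |R′| = trans (length-minus-·ₚ I c V |I|≡|V|) (Vec.length-toList v)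

  monic-*ₚ-degreeBelow⇒≈0 : ∀ M u B → coeffs M *ₚ u ≈ₚ B → DegreeBelow B (deg M) → u ≈ₚ 0ₚ
  monic-*ₚ-degreeBelow⇒≈0 M@(n , v) u B e B<n with zero-or-nonzero u
  ... | inj₁ u≈0 = u≈0
  ... | inj₂ (nonzero us β β≢0 u≈ _) with *ₚ-∷ʳ-lead (Vec.toList v) 1F us β
  ...   | zs , |zs| , Mu≈ = ⊥-elim (β≢0 (begin
    β                                  ≡⟨ *-identityˡ β ⟨
    1F *F β                            ≡⟨ coeff-∷ʳ zs (1F *F β) ⟨
    coeff (zs ∷ʳ (1F *F β)) (length zs) ≡⟨ coeff-≡ Mu≈ (length zs) ⟨
    coeff (coeffs M *ₚ (us ∷ʳ β)) (length zs) ≡⟨ coeff-≡ (*ₚ-congʳ (coeffs M) u≈) (length zs) ⟨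
    coeff (coeffs M *ₚ u) (length zs)  ≡⟨ coeff-≡ e (length zs) ⟩
    coeff B (length zs)                ≡⟨ B<n (length zs) n≤|zs| ⟩
    0F                                 ∎))
    where
    open ≡-Reasoning
    n≤|zs| : n ≤ length zs
    n≤|zs| = subst₂ _≤_ (Vec.length-toList v) (sym |zs|) (ℕ.m≤m+n _ (length us))

  *ₚ-cancelˡ-monic : ∀ M a b → coeffs M *ₚ a ≈ₚ coeffs M *ₚ b → a ≈ₚ b
  *ₚ-cancelˡ-monic M a b e = x∙y⁻¹≈ε⇒x≈y a b (monic-*ₚ-degreeBelow⇒≈0 M (a -ₚ b) 0ₚ M[a-b]≈0 (λ m _ → refl))
    where
    M[a-b]≈0 : coeffs M *ₚ (a -ₚ b) ≈ₚ 0ₚ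
    M[a-b]≈0 = ≈ₚ-trans (x[y-z]≈xy-xz (coeffs M) a b) (x≈y⇒x∙y⁻¹≈ε e)

  monic-quotient : ∀ A M w → coeffs A ≈ₚ coeffs M *ₚ w → Σ Monic λ W → coeffs W ≈ₚ w
  monic-quotient A M w e with zero-or-nonzero w
  ... | inj₁ w≈0 = ⊥-elim (coeffs≉0 A (≈ₚ-trans e (≈ₚ-trans (*ₚ-congʳ (coeffs M) w≈0) (*ₚ-zeroʳ (coeffs M)))))
  ... | inj₂ (nonzero ws γ γ≢0 w≈ _) with coeffs-monic M
  ...   | V , _ , M≈ with *ₚ-∷ʳ-lead V 1F ws γ
  ...     | zs , _ , Mw≈ = fromLower ws , ≈ₚ-trans (≈ₚ-reflexive (trans (coeffs-fromLower ws) (cong (ws ∷ʳ_) 1≡γ))) (≈ₚ-sym w≈)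
    where
    A≈ : coeffs A ≈ₚ zs ∷ʳ (1F *F γ)
    A≈ = ≈ₚ-trans e (≈ₚ-trans (*ₚ-cong M≈ w≈) Mw≈)
    1≡γ : 1F ≡ γ
    1≡γ with coeffs-monic A
    ... | L , _ , A≈L = trans (proj₂ (∷ʳ-injective-≈ₚ L zs 1≢0 (λ h → γ≢0 (trans (sym (*-identityˡ γ)) h))
                                  (≈ₚ-trans (≈ₚ-sym A≈L) A≈))) (*-identityˡ γ)

module Divisibility {q : ℕ} (F : FiniteField q) where
  open PolynomialRing F

  infix 4 _∣ₚ_
  record _∣ₚ_ (a b : Pol) : Set where
    constructor divides
    field
      quotient : Pol
      equation : a *ₚ quotient ≈ₚ b

  ∣ₚ-resp-≈ₚ : ∀ {p a b} → a ≈ₚ b → p ∣ₚ a → p ∣ₚ b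
  ∣ₚ-resp-≈ₚ a≈b (divides u pu≈a) = divides u (≈ₚ-trans pu≈a a≈b)

  ∣ₚ-*ₚ-self : ∀ p a → p ∣ₚ p *ₚ a
  ∣ₚ-*ₚ-self p a = divides a ≈ₚ-refl

  ∣ₚ-*ₚˡ : ∀ {p} a {b} → p ∣ₚ b → p ∣ₚ a *ₚ b
  ∣ₚ-*ₚˡ {p} a (divides u pu≈b) = divides (a *ₚ u) (≈ₚ-trans (*ₚ.x∙yz≈y∙xz p a u) (*ₚ-congʳ a pu≈b))

  ∣ₚ-*ₚʳ : ∀ {p a} b → p ∣ₚ a → p ∣ₚ a *ₚ b
  ∣ₚ-*ₚʳ {a = a} b p∣a = ∣ₚ-resp-≈ₚ (*ₚ-comm b a) (∣ₚ-*ₚˡ b p∣a)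

  ∣ₚ-minus : ∀ {p a b} → p ∣ₚ a → p ∣ₚ b → p ∣ₚ a -ₚ b
  ∣ₚ-minus {p} (divides u pu≈a) (divides v pv≈b) = divides (u -ₚ v)
    (≈ₚ-trans (x[y-z]≈xy-xz p u v) (+ₚ-cong pu≈a (negₚ-cong pv≈b)))

module Irreducibles {q : ℕ} (F : FiniteField q) where
  open FiniteField F
  open FieldProperties F
  open PolynomialRing F
  open LeadingCoefficients F
  open MonicPolynomials F
  open MonicDivision F
  open Divisibility F

  module _ (P : Monic) (irr : Irreducible P) where
    private
      p = coeffs P

      remainder≈0⇒∣ₚ : ∀ {a Q R} → a ≈ₚ p *ₚ Q +ₚ R → R ≈ₚ 0ₚ → p ∣ₚ a
      remainder≈0⇒∣ₚ {Q = Q} a≈ R≈0 = divides Q (≈ₚ-sym (≈ₚ-trans a≈ (+ₚ-≈0ʳ (p *ₚ Q) R≈0)))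

    ∣ₚ-degreeBelow⇒≈0 : ∀ B → DegreeBelow B (deg P) → p ∣ₚ B → B ≈ₚ 0ₚ
    ∣ₚ-degreeBelow⇒≈0 B B<P (divides u pu≈B) =
      ≈ₚ-trans (≈ₚ-sym pu≈B) (≈ₚ-trans (*ₚ-congʳ p (monic-*ₚ-degreeBelow⇒≈0 P u B pu≈B B<P)) (*ₚ-zeroʳ p))

    proper-factor-deg≡0 : ∀ A Q → deg A < deg P → p ≈ₚ coeffs A *ₚ Q → deg A ≡ 0
    proper-factor-deg≡0 A Q A<P p≈AQ with monic-quotient P A Q p≈AQ
    ... | W , W≈Q = [ id , (λ degW≡0 → ⊥-elim (ℕ.<-irrefl (degA≡degP degW≡0) A<P)) ]′
                      (proj₂ irr A W (*ₚ-coeffs-≡ A W P AW≈p))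
      where
      AW≈p : coeffs A *ₚ coeffs W ≈ₚ p
      AW≈p = ≈ₚ-trans (*ₚ-congʳ (coeffs A) W≈Q) (≈ₚ-sym p≈AQ)
      degA≡degP : deg W ≡ 0 → deg A ≡ deg P
      degA≡degP degW≡0 = begin
        deg A          ≡⟨ ℕ.+-identityʳ (deg A) ⟨
        deg A + 0      ≡⟨ cong (deg A +_) degW≡0 ⟨
        deg A + deg W  ≡⟨ deg-*ₚ A W P AW≈p ⟨
        deg P          ∎
        where open ≡-Reasoning

    -- Induction on deg A: reduce p modulo A; a nonzero remainder is a smaller A, a zero one contradicts irreducibility.
    ∣ₚ-small-product⇒≈0 : ∀ A → deg A < deg P → ∀ B → DegreeBelow B (deg P) → p ∣ₚ coeffs A *ₚ B → B ≈ₚ 0ₚ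
    ∣ₚ-small-product⇒≈0 A = go A (<-wellFounded (deg A))
      where
      go : ∀ A → Acc _<_ (deg A) → deg A < deg P → ∀ B → DegreeBelow B (deg P) → p ∣ₚ coeffs A *ₚ B → B ≈ₚ 0ₚ
      go A (acc smaller) A<P B B<P p∣AB with divide A p
      ... | Q , R , |R| , p≈ with zero-or-nonzero R
      ... | inj₁ R≈0 = ∣ₚ-degreeBelow⇒≈0 B B<P (∣ₚ-resp-≈ₚ AB≈B p∣AB)
        where
        degA≡0 : deg A ≡ 0
        degA≡0 = proper-factor-deg≡0 A Q A<P (≈ₚ-trans p≈ (+ₚ-≈0ʳ (coeffs A *ₚ Q) R≈0))
        AB≈B : coeffs A *ₚ B ≈ₚ B
        AB≈B = ≈ₚ-trans (*ₚ-congˡ B (≈ₚ-reflexive (deg≡0⇒coeffs≡1ₚ A degA≡0))) (*ₚ-identityˡ B)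
      ... | inj₂ nz with nonzero⇒lead·monic nz
      ...   | R̂ , degR̂ , R≈ρR̂ = ·ₚ-≈0⇒≈0 (Nonzero.lead≢0 nz)
                (go R̂ (smaller R̂<A) (ℕ.<-trans R̂<A A<P) (ρ ·ₚ B) (degreeBelow-·ₚ ρ B B<P) p∣R̂ρB)
        where
        ρ = Nonzero.lead nz
        R̂<A : deg R̂ < deg A
        R̂<A = subst₂ _<_ (sym degR̂) |R| (Nonzero.|init|<|c| nz)
        p∣R̂ρB : p ∣ₚ coeffs R̂ *ₚ (ρ ·ₚ B)
        p∣R̂ρB = ∣ₚ-resp-≈ₚ (begin
          p *ₚ B -ₚ (coeffs A *ₚ Q) *ₚ B   ≈⟨ [y-z]x≈yx-zx B p (coeffs A *ₚ Q) ⟨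
          (p -ₚ coeffs A *ₚ Q) *ₚ B        ≈⟨ *ₚ-congˡ B (+ₚ-move p≈) ⟨
          R *ₚ B                           ≈⟨ *ₚ-congˡ B R≈ρR̂ ⟩
          (ρ ·ₚ coeffs R̂) *ₚ B             ≈⟨ *ₚ-·ₚ-swap ρ (coeffs R̂) B ⟩
          coeffs R̂ *ₚ (ρ ·ₚ B)             ∎)
          (∣ₚ-minus (∣ₚ-*ₚ-self p B) (∣ₚ-resp-≈ₚ (*ₚ.x∙yz≈yx∙z Q (coeffs A) B) (∣ₚ-*ₚˡ Q p∣AB)))
          where open ≈ₚ-Reasoning

    euclid : ∀ a b → p ∣ₚ a *ₚ b → p ∣ₚ a ⊎ p ∣ₚ b
    euclid a b p∣ab with divide P a | divide P b
    ... | Qa , Ra , |Ra| , a≈ | Qb , Rb , |Rb| , b≈ with zero-or-nonzero Ra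
    ... | inj₁ Ra≈0 = inj₁ (remainder≈0⇒∣ₚ a≈ Ra≈0)
    ... | inj₂ nz with nonzero⇒lead·monic nz
    ...   | R̂a , degR̂a , Ra≈αR̂a = inj₂ (remainder≈0⇒∣ₚ b≈ Rb≈0)
      where
      open ≈ₚ-Reasoning
      α = Nonzero.lead nz
      R̂a<P : deg R̂a < deg P
      R̂a<P = subst₂ _<_ (sym degR̂a) |Ra| (Nonzero.|init|<|c| nz)
      p∣aRb : p ∣ₚ a *ₚ Rb
      p∣aRb = ∣ₚ-resp-≈ₚ (begin
        a *ₚ b -ₚ a *ₚ (p *ₚ Qb)  ≈⟨ x[y-z]≈xy-xz a b (p *ₚ Qb) ⟨
        a *ₚ (b -ₚ p *ₚ Qb)       ≈⟨ *ₚ-congʳ a (+ₚ-move b≈) ⟨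
        a *ₚ Rb                   ∎)
        (∣ₚ-minus p∣ab (∣ₚ-*ₚˡ a (∣ₚ-*ₚ-self p Qb)))
      p∣R̂aαRb : p ∣ₚ coeffs R̂a *ₚ (α ·ₚ Rb)
      p∣R̂aαRb = ∣ₚ-resp-≈ₚ (begin
        a *ₚ Rb -ₚ p *ₚ Qa *ₚ Rb  ≈⟨ [y-z]x≈yx-zx Rb a (p *ₚ Qa) ⟨
        (a -ₚ p *ₚ Qa) *ₚ Rb      ≈⟨ *ₚ-congˡ Rb (+ₚ-move a≈) ⟨
        Ra *ₚ Rb                  ≈⟨ *ₚ-congˡ Rb Ra≈αR̂a ⟩
        (α ·ₚ coeffs R̂a) *ₚ Rb    ≈⟨ *ₚ-·ₚ-swap α (coeffs R̂a) Rb ⟩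
        coeffs R̂a *ₚ (α ·ₚ Rb)    ∎)
        (∣ₚ-minus p∣aRb (∣ₚ-*ₚʳ Rb (∣ₚ-*ₚ-self p Qa)))
      Rb≈0 : Rb ≈ₚ 0ₚ
      Rb≈0 = ·ₚ-≈0⇒≈0 (Nonzero.lead≢0 nz) (∣ₚ-small-product⇒≈0 R̂a R̂a<P (α ·ₚ Rb)
               (degreeBelow-·ₚ α Rb (degreeBelow-length Rb |Rb|)) p∣R̂aαRb)

module Factorisation {q : ℕ} (F : FiniteField q) where
  open FiniteField F
  open PolynomialRing F
  open MonicPolynomials F
  open MonicDivision F
  open Divisibility F
  open Irreducibles F

  divisor-of-product : ∀ ps → (∀ p → p ∈ ps → Irreducible p) → ∀ D u →
    coeffs D *ₚ coeffs u ≈ₚ productM ps → Σ (List Monic) λ sub → sub ⊆ ps × coeffs D ≈ₚ productM sub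
  divisor-of-product [] _ D u Du≈1 = [] , ⊆.[] , ≈ₚ-reflexive (deg≡0⇒coeffs≡1ₚ D (ℕ.m+n≡0⇒m≡0 (deg D) (sym degDu≡0)))
    where
    degDu≡0 : 0 ≡ deg D + deg u
    degDu≡0 = deg-*ₚ D u (0 , Vec.[]) Du≈1
  divisor-of-product (p ∷ ps) irr D u Du≈pps
    with euclid p (irr p (here refl)) (coeffs D) (coeffs u) (divides (productM ps) (≈ₚ-sym Du≈pps))
  ... | inj₁ (divides w pw≈D) with monic-quotient D p w (≈ₚ-sym pw≈D)
  ...   | W , W≈w with divisor-of-product ps (λ p′ → irr p′ ∘ there) W u Wu≈ps
    where
    Wu≈ps : coeffs W *ₚ coeffs u ≈ₚ productM ps
    Wu≈ps = *ₚ-cancelˡ-monic p _ _ (begin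
      coeffs p *ₚ (coeffs W *ₚ coeffs u)   ≈⟨ *ₚ-assoc (coeffs p) (coeffs W) (coeffs u) ⟨
      coeffs p *ₚ coeffs W *ₚ coeffs u     ≈⟨ *ₚ-congˡ (coeffs u) (≈ₚ-trans (*ₚ-congʳ (coeffs p) W≈w) pw≈D) ⟩
      coeffs D *ₚ coeffs u                 ≈⟨ Du≈pps ⟩
      coeffs p *ₚ productM ps              ∎)
      where open ≈ₚ-Reasoning
  ...     | sub , sub⊆ps , W≈sub = p ∷ sub , refl ⊆.∷ sub⊆ps ,
    ≈ₚ-trans (≈ₚ-sym pw≈D) (*ₚ-congʳ (coeffs p) (≈ₚ-trans (≈ₚ-sym W≈w) W≈sub))
  divisor-of-product (p ∷ ps) irr D u Du≈pps
    | inj₂ (divides w pw≈u) with monic-quotient u p w (≈ₚ-sym pw≈u)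
  ...   | W , W≈w with divisor-of-product ps (λ p′ → irr p′ ∘ there) D W DW≈ps
    where
    DW≈ps : coeffs D *ₚ coeffs W ≈ₚ productM ps
    DW≈ps = *ₚ-cancelˡ-monic p _ _ (begin
      coeffs p *ₚ (coeffs D *ₚ coeffs W)   ≈⟨ *ₚ.x∙yz≈y∙xz (coeffs p) (coeffs D) (coeffs W) ⟩
      coeffs D *ₚ (coeffs p *ₚ coeffs W)   ≈⟨ *ₚ-congʳ (coeffs D) (≈ₚ-trans (*ₚ-congʳ (coeffs p) W≈w) pw≈u) ⟩
      coeffs D *ₚ coeffs u                 ≈⟨ Du≈pps ⟩
      coeffs p *ₚ productM ps              ∎)
      where open ≈ₚ-Reasoning
  ...     | sub , sub⊆ps , D≈sub = sub , p ⊆.∷ʳ sub⊆ps , D≈sub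

module ListCounting where
  private module ℕ+ = CommutativeSemigroupProperties ℕ.+-commutativeSemigroup
  open import Data.Nat.Combinatorics using (_C_; nCk+nC[k+1]≡[n+1]C[k+1])

  length-concatMap : ∀ {A B : Set} (f : A → List B) xs → length (concatMap f xs) ≡ sum (map (length ∘ f) xs)
  length-concatMap f []       = refl
  length-concatMap f (x ∷ xs) = trans (length-++ (f x)) (cong (length (f x) +_) (length-concatMap f xs))

  ∈⇒≤sum-map : ∀ {A : Set} (f : A → ℕ) {x} xs → x ∈ xs → f x ≤ sum (map f xs)
  ∈⇒≤sum-map f (x ∷ xs) (here refl)  = ℕ.m≤m+n (f x) _
  ∈⇒≤sum-map f (y ∷ xs) (there x∈xs) = ℕ.≤-trans (∈⇒≤sum-map f xs x∈xs) (ℕ.m≤n+m _ (f y))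

  sum-map-const : ∀ {A : Set} n (xs : List A) → sum (map (λ _ → n) xs) ≡ length xs * n
  sum-map-const n []       = refl
  sum-map-const n (x ∷ xs) = cong (n +_) (sum-map-const n xs)

  length-concatMap-const : ∀ {A B : Set} (f : A → List B) n xs →
    (∀ x → x ∈ xs → length (f x) ≡ n) → length (concatMap f xs) ≡ length xs * n
  length-concatMap-const f n xs |f|≡n = trans (length-concatMap f xs)
    (trans (cong sum (map-cong-local (All.tabulate λ {x} x∈xs → |f|≡n x x∈xs))) (sum-map-const n xs))

  countTrue≤length : ∀ {A B : Set} (χ : A → Bool) (R : A → B → Set) →
    (∀ {x x′ y} → R x y → R x′ y → x ≡ x′) →
    ∀ xs → Unique xs → (L : List B) → (∀ x → x ∈ xs → χ x ≡ true → Σ B λ y → y ∈ L × R x y) →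
    countTrue χ xs ≤ length L
  countTrue≤length χ R R-injective []       _           L hit = z≤n
  countTrue≤length χ R R-injective (x ∷ xs) (x∉xs ∷ xs!) L hit with χ x Bool.≟ true
  ... | no  _     = countTrue≤length χ R R-injective xs xs! L (λ x′ → hit x′ ∘ there)
  ... | yes χx with hit x (here refl) χx
  ...   | y , y∈L , Rxy with ∈-∃++ y∈L
  ...     | L₁ , L₂ , refl = subst (suc (countTrue χ xs) ≤_) (sym (length-++-sucʳ L₁ y L₂))
    (s≤s (countTrue≤length χ R R-injective xs xs! (L₁ ++ L₂) hit′))
    where
    hit′ : ∀ x′ → x′ ∈ xs → χ x′ ≡ true → Σ _ λ y′ → y′ ∈ L₁ ++ L₂ × R x′ y′
    hit′ x′ x′∈xs χx′ with hit x′ (there x′∈xs) χx′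
    ... | y′ , y′∈L , Rx′y′ with ∈-++⁻ L₁ y′∈L
    ...   | inj₁ y′∈L₁         = y′ , ∈-++⁺ˡ y′∈L₁ , Rx′y′
    ...   | inj₂ (there y′∈L₂) = y′ , ∈-++⁺ʳ L₁ y′∈L₂ , Rx′y′
    ...   | inj₂ (here refl)   = ⊥-elim (All.lookup x∉xs x′∈xs (R-injective Rxy Rx′y′))

  allVecs≡cartesianProduct : ∀ q d → allVecs q (suc d) ≡ cartesianProductWith Vec._∷_ (allFin q) (allVecs q d)
  allVecs≡cartesianProduct q d = go (allFin q)
    where
    go : ∀ xs → concatMap (λ x → map (x Vec.∷_) (allVecs q d)) xs ≡ cartesianProductWith Vec._∷_ xs (allVecs q d)
    go []       = refl
    go (x ∷ xs) = cong (map (x Vec.∷_) (allVecs q d) ++_) (go xs)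

  allVecs-unique : ∀ q d → Unique (allVecs q d)
  allVecs-unique q zero    = All.[] ∷ []
  allVecs-unique q (suc d) = subst Unique (sym (allVecs≡cartesianProduct q d))
    (Unique.cartesianProductWith⁺ Vec._∷_ (λ eq → Vec.∷-injective eq) (Unique.allFin⁺ q) (allVecs-unique q d))

  ∈-allVecs : ∀ q d (v : Vec (Fin q) d) → v ∈ allVecs q d
  ∈-allVecs q zero    Vec.[]       = here refl
  ∈-allVecs q (suc d) (x Vec.∷ v) = subst (_ ∈_) (sym (allVecs≡cartesianProduct q d))
    (∈-cartesianProductWith⁺ Vec._∷_ (∈-allFin x) (∈-allVecs q d v))

  length-allVecs : ∀ q d → length (allVecs q d) ≡ q ^ d
  length-allVecs q zero    = refl
  length-allVecs q (suc d) = begin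
    length (allVecs q (suc d))          ≡⟨ length-concatMap-const _ (q ^ d) (allFin q)
                                             (λ x _ → trans (length-map _ (allVecs q d)) (length-allVecs q d)) ⟩
    length (allFin q) * q ^ d           ≡⟨ cong (_* q ^ d) (length-tabulate {n = q} id) ⟩
    q * q ^ d                           ∎
    where open ≡-Reasoning

  sum-map-filter-partition : ∀ {A : Set} {P : A → Set} (P? : Decidable P) (f : A → ℕ) xs →
    sum (map f xs) ≡ sum (map f (filter P? xs)) + sum (map f (filter (¬? ∘ P?) xs))
  sum-map-filter-partition P? f []       = refl
  sum-map-filter-partition P? f (x ∷ xs) with P? x
  ... | yes _ = trans (cong (f x +_) (sum-map-filter-partition P? f xs)) (sym (ℕ.+-assoc (f x) _ _))
  ... | no  _ = trans (cong (f x +_) (sum-map-filter-partition P? f xs)) (ℕ+.x∙yz≈y∙xz (f x) (sum (map f (filter P? xs))) (sum (map f (filter (¬? ∘ P?) xs))))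

  module _ {A : Set} where

    sublistsOfLength : ℕ → List A → List (List A)
    sublistsOfLength zero    xs       = [] ∷ []
    sublistsOfLength (suc h) []       = []
    sublistsOfLength (suc h) (x ∷ xs) = map (x ∷_) (sublistsOfLength h xs) ++ sublistsOfLength (suc h) xs

    length-sublistsOfLength : ∀ h (xs : List A) → length (sublistsOfLength h xs) ≡ length xs C h
    length-sublistsOfLength zero    xs       = refl
    length-sublistsOfLength (suc h) []       = refl
    length-sublistsOfLength (suc h) (x ∷ xs) = begin
      length (map (x ∷_) (sublistsOfLength h xs) ++ sublistsOfLength (suc h) xs)
        ≡⟨ length-++ (map (x ∷_) (sublistsOfLength h xs)) ⟩
      length (map (x ∷_) (sublistsOfLength h xs)) + length (sublistsOfLength (suc h) xs)
        ≡⟨ cong₂ _+_ (trans (length-map _ (sublistsOfLength h xs)) (length-sublistsOfLength h xs))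
                     (length-sublistsOfLength (suc h) xs) ⟩
      length xs C h + length xs C suc h
        ≡⟨ nCk+nC[k+1]≡[n+1]C[k+1] (length xs) h ⟩
      suc (length xs) C suc h ∎
      where open ≡-Reasoning

    ∈-sublistsOfLength : ∀ {S xs : List A} → S ⊆ xs → S ∈ sublistsOfLength (length S) xs
    ∈-sublistsOfLength ⊆.[]                  = here refl
    ∈-sublistsOfLength {[]}    (y ⊆.∷ʳ _)     = here refl
    ∈-sublistsOfLength {_ ∷ S} (y ⊆.∷ʳ S⊆xs) = ∈-++⁺ʳ (map (y ∷_) (sublistsOfLength (length S) _)) (∈-sublistsOfLength S⊆xs)
    ∈-sublistsOfLength (refl ⊆.∷ S⊆xs)        = ∈-++⁺ˡ (∈-map⁺ _ (∈-sublistsOfLength S⊆xs))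

module Subproducts {q : ℕ} (F : FiniteField q) (ps : List (Poly.Monic F)) (λs : ℕ → ℕ) where
  open FiniteField F
  open PolynomialRing F
  open ListCounting
  open Tuples λs
  open import Data.Nat.Combinatorics using (_C_)
  private module ⊆Props = Data.List.Relation.Binary.Sublist.Setoid.Properties (setoid Monic)

  factorsOfDegree : ℕ → List Monic
  factorsOfDegree t = filter (λ p → deg p ≟ t) ps

  subproducts : ℕ → List ℕ → List Pol
  subproducts t []       = 1ₚ ∷ []
  subproducts t (h ∷ hs) =
    concatMap (λ S → map (productM S *ₚ_) (subproducts (suc t) hs)) (sublistsOfLength h (factorsOfDegree t))

  subproductsOfDegree : ℕ → ℕ → List Pol
  subproductsOfDegree k j =
    concatMap (λ hs → if ⌊ weight k hs ≟ j ⌋ then subproducts k hs else []) (boxes k (suc j ∸ k))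

  CountsFactors : ℕ → ℕ → Set
  CountsFactors a b = ∀ i → a ≤ i → i < b → length (factorsOfDegree i) ≡ λs i

  length-subproducts : ∀ t hs → CountsFactors t (t + length hs) → length (subproducts t hs) ≡ binomProd t hs
  length-subproducts t []       _      = refl
  length-subproducts t (h ∷ hs) counts = begin
    length (subproducts t (h ∷ hs))
      ≡⟨ length-concatMap-const _ (binomProd (suc t) hs) (sublistsOfLength h (factorsOfDegree t))
           (λ S _ → trans (length-map _ (subproducts (suc t) hs)) (length-subproducts (suc t) hs counts′)) ⟩
    length (sublistsOfLength h (factorsOfDegree t)) * binomProd (suc t) hs
      ≡⟨ cong (_* binomProd (suc t) hs) (length-sublistsOfLength h (factorsOfDegree t)) ⟩
    (length (factorsOfDegree t) C h) * binomProd (suc t) hs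
      ≡⟨ cong (λ n → (n C h) * binomProd (suc t) hs) (counts t ℕ.≤-refl (ℕ.m<m+n t (s≤s z≤n))) ⟩
    (λs t C h) * binomProd (suc t) hs ∎
    where
    open ≡-Reasoning
    counts′ : CountsFactors (suc t) (suc t + length hs)
    counts′ i t<i i<end = counts i (ℕ.<⇒≤ t<i) (subst (i <_) (sym (ℕ.+-suc t (length hs))) i<end)

  length-∈-boxes : ∀ t len {hs} → hs ∈ boxes t len → length hs ≡ len
  length-∈-boxes t zero    (here refl) = refl
  length-∈-boxes t (suc len) hs∈ with find (∈-concatMap⁻ (λ h → map (h ∷_) (boxes (suc t) len)) {xs = upTo (suc (λs t))} hs∈)
  ... | h , _ , hs∈h∷boxes with ∈-map⁻ (h ∷_) hs∈h∷boxes
  ...   | hs′ , hs′∈ , refl = cong suc (length-∈-boxes (suc t) len hs′∈)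

  length-subproductsOfDegree : ∀ k j → CountsFactors k (suc j) → length (subproductsOfDegree k j) ≡ innerSum k j
  length-subproductsOfDegree k j counts = trans (length-concatMap _ (boxes k (suc j ∸ k)))
    (cong sum (map-cong-local (All.tabulate λ {hs} → summand hs)))
    where
    window : ∀ {i} → k ≤ i → i < k + (suc j ∸ k) → i < suc j
    window {i} k≤i i<end with k ≤? suc j
    ... | yes k≤1+j = subst (i <_) (ℕ.m+[n∸m]≡n k≤1+j) i<end
    ... | no  k≰1+j = ⊥-elim (ℕ.<-irrefl refl (ℕ.≤-<-trans k≤i
                        (subst (i <_) (trans (cong (k +_) (ℕ.m≤n⇒m∸n≡0 (ℕ.<⇒≤ (ℕ.≰⇒> k≰1+j)))) (ℕ.+-identityʳ k)) i<end)))
    summand : ∀ hs → hs ∈ boxes k (suc j ∸ k) →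
      length (if ⌊ weight k hs ≟ j ⌋ then subproducts k hs else []) ≡ (if ⌊ weight k hs ≟ j ⌋ then binomProd k hs else 0)
    summand hs hs∈ with weight k hs ≟ j
    ... | no  _ = refl
    ... | yes _ = length-subproducts k hs λ i k≤i i<end →
      counts i k≤i (window k≤i (subst (λ l → i < k + l) (length-∈-boxes k (suc j ∸ k) hs∈) i<end))

  productM-partition : ∀ {P : Monic → Set} (P? : Decidable P) xs →
    productM xs ≈ₚ productM (filter P? xs) *ₚ productM (filter (¬? ∘ P?) xs)
  productM-partition P? []       = ≈ₚ-sym (*ₚ-identityˡ 1ₚ)
  productM-partition P? (x ∷ xs) with P? x
  ... | yes _ = ≈ₚ-trans (*ₚ-congʳ (coeffs x) (productM-partition P? xs)) (≈ₚ-sym (*ₚ-assoc (coeffs x) (productM (filter P? xs)) (productM (filter (¬? ∘ P?) xs))))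
  ... | no  _ = ≈ₚ-trans (*ₚ-congʳ (coeffs x) (productM-partition P? xs)) (*ₚ.x∙yz≈y∙xz (coeffs x) (productM (filter P? xs)) (productM (filter (¬? ∘ P?) xs)))

  sum-map-deg-const : ∀ t (xs : List Monic) → (∀ p → p ∈ xs → deg p ≡ t) → sum (map deg xs) ≡ t * length xs
  sum-map-deg-const t []       _       = sym (ℕ.*-zeroʳ t)
  sum-map-deg-const t (x ∷ xs) deg≡t = trans
    (cong₂ _+_ (deg≡t x (here refl)) (sum-map-deg-const t xs (λ p → deg≡t p ∘ there))) (sym (ℕ.*-suc t (length xs)))

  ∈-subproducts : ∀ len t sub → sub ⊆ ps → (∀ p → p ∈ sub → t ≤ deg p × deg p < t + len) →
    CountsFactors t (t + len) →
    Σ (List ℕ) λ hs → hs ∈ boxes t len × weight t hs ≡ sum (map deg sub) ×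
                      Σ Pol λ a → a ∈ subproducts t hs × a ≈ₚ productM sub
  ∈-subproducts zero t [] _ _ _ = [] , here refl , refl , 1ₚ , here refl , ≈ₚ-refl
  ∈-subproducts zero t (p ∷ sub) _ window _ with window p (here refl)
  ... | t≤p , p<t+0 = ⊥-elim (ℕ.<-irrefl refl (ℕ.≤-<-trans t≤p (subst (deg p <_) (ℕ.+-identityʳ t) p<t+0)))
  ∈-subproducts (suc len) t sub sub⊆ps window counts
    with ∈-subproducts len (suc t) rest (⊆.⊆-trans (⊆Props.filter-⊆ (¬? ∘ ofDegree?) sub) sub⊆ps) window′ counts′
    where
    ofDegree? : Decidable (λ p → deg p ≡ t)
    ofDegree? p = deg p ≟ t
    rest = filter (¬? ∘ ofDegree?) sub
    window′ : ∀ p → p ∈ rest → suc t ≤ deg p × deg p < suc t + len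
    window′ p p∈rest with ∈-filter⁻ (¬? ∘ ofDegree?) p∈rest
    ... | p∈sub , p≢t with window p p∈sub
    ...   | t≤p , p<end = ℕ.≤∧≢⇒< t≤p (p≢t ∘ sym) , subst (deg p <_) (ℕ.+-suc t len) p<end
    counts′ : CountsFactors (suc t) (suc t + len)
    counts′ i t<i i<end = counts i (ℕ.<⇒≤ t<i) (subst (i <_) (sym (ℕ.+-suc t len)) i<end)
  ... | hs , hs∈ , weight≡ , a , a∈ , a≈ = h ∷ hs , h∷hs∈ , weight≡′ , productM S *ₚ a , Sa∈ , Sa≈
    where
    ofDegree? : Decidable (λ p → deg p ≡ t)
    ofDegree? p = deg p ≟ t
    S = filter ofDegree? sub
    h = length S
    S⊆ : S ⊆ factorsOfDegree t
    S⊆ = ⊆Props.filter⁺ ofDegree? ofDegree? (λ { refl → id }) sub⊆ps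
    h≤λt : h ≤ λs t
    h≤λt = subst (h ≤_) (counts t ℕ.≤-refl (ℕ.m<m+n t (s≤s z≤n))) (⊆Props.length-mono-≤ S⊆)
    h∷hs∈ : h ∷ hs ∈ boxes t (suc len)
    h∷hs∈ = ∈-concatMap⁺ (λ h → map (h ∷_) (boxes (suc t) len)) (lose (∈-upTo⁺ (s≤s h≤λt)) (∈-map⁺ (h ∷_) hs∈))
    weight≡′ : t * h + weight (suc t) hs ≡ sum (map deg sub)
    weight≡′ = trans (cong₂ _+_ (sym (sum-map-deg-const t S (λ p → proj₂ ∘ ∈-filter⁻ ofDegree? {xs = sub}))) weight≡)
                     (sym (sum-map-filter-partition ofDegree? deg sub))
    Sa∈ : productM S *ₚ a ∈ subproducts t (h ∷ hs)
    Sa∈ = ∈-concatMap⁺ (λ S′ → map (productM S′ *ₚ_) (subproducts (suc t) hs))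
            (lose (∈-sublistsOfLength S⊆) (∈-map⁺ (productM S *ₚ_) a∈))
    Sa≈ : productM S *ₚ a ≈ₚ productM sub
    Sa≈ = ≈ₚ-trans (*ₚ-congʳ (productM S) a≈) (≈ₚ-sym (productM-partition ofDegree? sub))

  ∈-subproductsOfDegree : ∀ k j sub → sub ⊆ ps → (∀ p → p ∈ sub → k ≤ deg p) → sum (map deg sub) ≡ j →
    CountsFactors k (suc j) → k ≤ j → Σ Pol λ a → a ∈ subproductsOfDegree k j × a ≈ₚ productM sub
  ∈-subproductsOfDegree k j sub sub⊆ps k≤deg sum≡j counts k≤j
    with ∈-subproducts (suc j ∸ k) k sub sub⊆ps window (λ i k≤i i<end → counts i k≤i (subst (i <_) end≡ i<end))
    where
    end≡ : k + (suc j ∸ k) ≡ suc j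
    end≡ = ℕ.m+[n∸m]≡n (ℕ.m≤n⇒m≤1+n k≤j)
    window : ∀ p → p ∈ sub → k ≤ deg p × deg p < k + (suc j ∸ k)
    window p p∈sub = k≤deg p p∈sub , subst (deg p <_) (sym end≡) (s≤s (subst (deg p ≤_) sum≡j (∈⇒≤sum-map deg sub p∈sub)))
  ... | hs , hs∈ , weight≡ , a , a∈ , a≈ =
    a , ∈-concatMap⁺ (λ hs → if ⌊ weight k hs ≟ j ⌋ then subproducts k hs else []) (lose hs∈ (a∈selected (weight k hs ≟ j))) , a≈
    where
    a∈selected : (w≟j : Dec (weight k hs ≡ j)) → a ∈ (if ⌊ w≟j ⌋ then subproducts k hs else [])
    a∈selected (yes _)  = a∈
    a∈selected (no w≢j) = ⊥-elim (w≢j (trans weight≡ sum≡j))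

module RangeSums where

  Σ< : ℕ → (ℕ → ℕ) → ℕ
  Σ< zero    h = 0
  Σ< (suc n) h = h 0 + Σ< n (h ∘ suc)

  sum-map-applyUpTo : ∀ (F g : ℕ → ℕ) n → sum (map F (applyUpTo g n)) ≡ Σ< n (F ∘ g)
  sum-map-applyUpTo F g zero    = refl
  sum-map-applyUpTo F g (suc n) = cong (F (g 0) +_) (sum-map-applyUpTo F (g ∘ suc) n)

  sumRange≡Σ< : ∀ a b f → sumRange a b f ≡ Σ< (suc b ∸ a) (λ t → f (a + t))
  sumRange≡Σ< a b f = sum-map-applyUpTo (λ t → f (a + t)) id (suc b ∸ a)

  Σ<-mono-≤ : ∀ n {h h′} → (∀ t → t < n → h t ≤ h′ t) → Σ< n h ≤ Σ< n h′
  Σ<-mono-≤ zero    _    = z≤n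
  Σ<-mono-≤ (suc n) h≤h′ = ℕ.+-mono-≤ (h≤h′ 0 (s≤s z≤n)) (Σ<-mono-≤ n (λ t t<n → h≤h′ (suc t) (s≤s t<n)))

  Σ<-cong : ∀ n {h h′} → (∀ t → t < n → h t ≡ h′ t) → Σ< n h ≡ Σ< n h′
  Σ<-cong n {h} {h′} h≡h′ = ℕ.≤-antisym (Σ<-mono-≤ n (λ t t<n → ℕ.≤-reflexive (h≡h′ t t<n)))
                               (Σ<-mono-≤ n (λ t t<n → ℕ.≤-reflexive (sym (h≡h′ t t<n))))

  Σ<-distrib-+ : ∀ n f g → Σ< n (λ t → f t + g t) ≡ Σ< n f + Σ< n g
  Σ<-distrib-+ zero    f g = refl
  Σ<-distrib-+ (suc n) f g = trans (cong (f 0 + g 0 +_) (Σ<-distrib-+ n (f ∘ suc) (g ∘ suc)))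
    (ℕ+.interchange (f 0) (g 0) (Σ< n (f ∘ suc)) (Σ< n (g ∘ suc)))
    where module ℕ+ = CommutativeSemigroupProperties ℕ.+-commutativeSemigroup

  -- H s is counted once for every t ≤ s.
  Σ<-triangle : ∀ n (H : ℕ → ℕ) → Σ< n (λ t → Σ< (n ∸ t) (λ s → H (t + s))) ≡ Σ< n (λ t → suc t * H t)
  Σ<-triangle zero    H = refl
  Σ<-triangle (suc n) H = begin
    Σ< (suc n) H + Σ< n (λ t → Σ< (n ∸ t) (λ s → H (suc t + s)))
      ≡⟨ cong (Σ< (suc n) H +_) (Σ<-triangle n (H ∘ suc)) ⟩
    (H 0 + Σ< n (H ∘ suc)) + Σ< n (λ t → suc t * H (suc t))
      ≡⟨ ℕ.+-assoc (H 0) _ _ ⟩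
    H 0 + (Σ< n (H ∘ suc) + Σ< n (λ t → suc t * H (suc t)))
      ≡⟨ cong₂ _+_ (sym (ℕ.+-identityʳ (H 0))) (sym (Σ<-distrib-+ n (H ∘ suc) (λ t → suc t * H (suc t)))) ⟩
    1 * H 0 + Σ< n (λ t → suc (suc t) * H (suc t)) ∎
    where open ≡-Reasoning

  sumRange-mono-≤ : ∀ a b {f g} → (∀ i → a ≤ i → i ≤ b → f i ≤ g i) → sumRange a b f ≤ sumRange a b g
  sumRange-mono-≤ a b {f} {g} f≤g = subst₂ _≤_ (sym (sumRange≡Σ< a b f)) (sym (sumRange≡Σ< a b g))
    (Σ<-mono-≤ (suc b ∸ a) λ t t<n → f≤g (a + t) (ℕ.m≤m+n a t) (a+t≤b t t<n))
    where
    a+t≤b : ∀ t → t < suc b ∸ a → a + t ≤ b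
    a+t≤b t t<n = ℕ.≤-pred (subst (a + t <_) (ℕ.m+[n∸m]≡n a≤1+b) (ℕ.+-monoʳ-< a t<n))
      where
      a≤1+b : a ≤ suc b
      a≤1+b = ℕ.≮⇒≥ (λ 1+b<a → ℕ.n≮0 (subst (t <_) (ℕ.m≤n⇒m∸n≡0 (ℕ.<⇒≤ 1+b<a)) t<n))

  sumRange-cong : ∀ a b {f g} → (∀ i → f i ≡ g i) → sumRange a b f ≡ sumRange a b g
  sumRange-cong a b {f} {g} f≡g = cong sum (map-cong (λ t → f≡g (a + t)) (upTo (suc b ∸ a)))

  sumRange-triangle : ∀ a b (h : ℕ → ℕ) → sumRange a b (λ i → sumRange i b h) ≡ sumRange a b (λ j → (suc j ∸ a) * h j)
  sumRange-triangle a b h = begin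
    sumRange a b (λ i → sumRange i b h)
      ≡⟨ sumRange≡Σ< a b (λ i → sumRange i b h) ⟩
    Σ< n (λ t → sumRange (a + t) b h)
      ≡⟨ Σ<-cong n (λ t _ → trans (sumRange≡Σ< (a + t) b h) (cong₂ Σ< (sym (ℕ.∸-+-assoc (suc b) a t)) refl)) ⟩
    Σ< n (λ t → Σ< (n ∸ t) (λ s → h (a + t + s)))
      ≡⟨ Σ<-cong n (λ t _ → Σ<-cong (n ∸ t) (λ s _ → cong h (ℕ.+-assoc a t s))) ⟩
    Σ< n (λ t → Σ< (n ∸ t) (λ s → h (a + (t + s))))
      ≡⟨ Σ<-triangle n (λ t → h (a + t)) ⟩
    Σ< n (λ t → suc t * h (a + t))
      ≡⟨ Σ<-cong n (λ t _ → cong (_* h (a + t)) (sym (trans (cong (_∸ a) (sym (ℕ.+-suc a t))) (ℕ.m+n∸m≡n a (suc t))))) ⟩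
    Σ< n (λ t → (suc (a + t) ∸ a) * h (a + t))
      ≡⟨ sumRange≡Σ< a b (λ j → (suc j ∸ a) * h j) ⟨
    sumRange a b (λ j → (suc j ∸ a) * h j) ∎
    where
    open ≡-Reasoning
    n = suc b ∸ a

module GcdDegreeCount {q : ℕ} (F : FiniteField q) (g : Poly.Monic F) (ps : List (Poly.Monic F))
    (irreducible : ∀ p → p ∈ ps → Poly.Irreducible F p) (g≡ : Poly.productM F ps ≡ Poly.coeffs F g)
    (λs : ℕ → ℕ) (counts : ∀ i → 1 ≤ i → i ≤ Poly.deg F g → λs i ≡ Poly.countDeg F i ps)
    (k : ℕ) (1≤k : 1 ≤ k) (λ<k≡0 : ∀ i → 1 ≤ i → i < k → λs i ≡ 0)
    (d : ℕ) (d≤e : d ≤ Poly.deg F g) where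
  open FiniteField F
  open PolynomialRing F
  open MonicPolynomials F
  open Factorisation F
  open Subproducts F ps λs
  open ListCounting
  open RangeSums
  open Tuples λs using (innerSum)

  countsFactors : ∀ j → j ≤ d → CountsFactors k (suc j)
  countsFactors j j≤d i k≤i i<1+j = sym (counts i (ℕ.≤-trans 1≤k k≤i) (ℕ.≤-trans (ℕ.≤-pred i<1+j) (ℕ.≤-trans j≤d d≤e)))

  factor-deg≥k : ∀ p → p ∈ ps → k ≤ deg p
  factor-deg≥k p p∈ps = ℕ.≮⇒≥ λ p<k → ℕ.<-irrefl (sym (λ<k≡0 (deg p) 1≤p p<k))
    (subst (0 <_) (sym (counts (deg p) 1≤p p≤e)) (∈-length (∈-filter⁺ (λ p′ → deg p′ ≟ deg p) p∈ps refl)))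
    where
    1≤p : 1 ≤ deg p
    1≤p = proj₁ (irreducible p p∈ps)
    p≤e : deg p ≤ deg g
    p≤e = subst (deg p ≤_) (sym (deg-productM g ps (≈ₚ-reflexive (sym g≡)))) (∈⇒≤sum-map deg ps p∈ps)

  common-divisor-factorisation : ∀ f j → k ≤ j → j ≤ d → DegGcd g f j →
    Σ Pol λ A → A ∈ subproductsOfDegree k j × Σ Monic λ U → coeffs f ≈ₚ A *ₚ coeffs U × deg f ≡ j + deg U
  common-divisor-factorisation f j k≤j j≤d (D , degD , (u , Du≡g) , (U , DU≡f) , _)
    with divisor-of-product ps irreducible D u (≈ₚ-reflexive (trans Du≡g (sym g≡)))
  ... | sub , sub⊆ps , D≈sub
    with ∈-subproductsOfDegree k j sub sub⊆ps (λ p → factor-deg≥k p ∘ ⊆.lookup sub⊆ps)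
           (trans (sym (deg-productM D sub D≈sub)) degD) (countsFactors j j≤d) k≤j
  ... | A , A∈ , A≈sub = A , A∈ , U ,
    ≈ₚ-trans (≈ₚ-reflexive (sym DU≡f)) (*ₚ-congˡ (coeffs U) (≈ₚ-trans D≈sub (≈ₚ-sym A≈sub))) ,
    trans (deg-*ₚ D U f (≈ₚ-reflexive DU≡f)) (cong (_+ deg U) degD)

  candidates : ℕ → List Pol
  candidates j = concatMap (λ A → map (λ w → A *ₚ coeffs (d ∸ j , w)) (allVecs q (d ∸ j))) (subproductsOfDegree k j)

  candidatesFrom : ℕ → List Pol
  candidatesFrom i = concatMap candidates (map (i +_) (upTo (suc d ∸ i)))

  bound-B : ℕ → ℕ
  bound-B j = q ^ (d ∸ j) * innerSum k j

  length-candidates : ∀ j → j ≤ d → length (candidates j) ≡ bound-B j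
  length-candidates j j≤d = begin
    length (candidates j)
      ≡⟨ length-concatMap-const _ (q ^ (d ∸ j)) (subproductsOfDegree k j)
           (λ A _ → trans (length-map _ (allVecs q (d ∸ j))) (length-allVecs q (d ∸ j))) ⟩
    length (subproductsOfDegree k j) * q ^ (d ∸ j)
      ≡⟨ cong (_* q ^ (d ∸ j)) (length-subproductsOfDegree k j (countsFactors j j≤d)) ⟩
    innerSum k j * q ^ (d ∸ j)
      ≡⟨ ℕ.*-comm (innerSum k j) (q ^ (d ∸ j)) ⟩
    bound-B j ∎
    where open ≡-Reasoning

  length-candidatesFrom : ∀ i → length (candidatesFrom i) ≤ sumRange i d bound-B
  length-candidatesFrom i = subst (_≤ sumRange i d bound-B) (sym length≡)
    (sumRange-mono-≤ i d (λ j _ j≤d → ℕ.≤-reflexive (length-candidates j j≤d)))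
    where
    length≡ : length (candidatesFrom i) ≡ sumRange i d (length ∘ candidates)
    length≡ = trans (length-concatMap candidates (map (i +_) (upTo (suc d ∸ i))))
                    (cong sum (sym (map-∘ (upTo (suc d ∸ i)))))

  ∈-candidatesFrom : ∀ i v → k ≤ i → ∃[ j ] (i ≤ j × j ≤ d × DegGcd g (d , v) j) →
    Σ Pol λ c → c ∈ candidatesFrom i × coeffs (d , v) ≈ₚ c
  ∈-candidatesFrom i v k≤i (j , i≤j , j≤d , gcd) with common-divisor-factorisation (d , v) j (ℕ.≤-trans k≤i i≤j) j≤d gcd
  ... | A , A∈ , U , v≈AU , d≡j+U with vectorOfDegree U (sym (trans (cong (_∸ j) d≡j+U) (ℕ.m+n∸m≡n j (deg U))))
  ... | w , w≡U = A *ₚ coeffs (d ∸ j , w) , c∈ , ≈ₚ-trans v≈AU (*ₚ-congʳ A (≈ₚ-reflexive (sym w≡U)))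
    where
    j∈ : j ∈ map (i +_) (upTo (suc d ∸ i))
    j∈ = subst (_∈ map (i +_) (upTo (suc d ∸ i))) (ℕ.m+[n∸m]≡n i≤j)
           (∈-map⁺ (i +_) (∈-upTo⁺ (ℕ.∸-monoˡ-< (s≤s j≤d) i≤j)))
    c∈ : A *ₚ coeffs (d ∸ j , w) ∈ candidatesFrom i
    c∈ = ∈-concatMap⁺ candidates (lose j∈ (∈-concatMap⁺ _ (lose A∈ (∈-map⁺ _ (∈-allVecs q (d ∸ j) w)))))

  union-card≤ : ∀ i {n} → k ≤ i → HasCard {q} {d} (λ f → ∃[ j ] (i ≤ j × j ≤ d × DegGcd g (d , f) j)) n →
    n ≤ sumRange i d bound-B
  union-card≤ i k≤i (χ , χ⇔ , count≡n) = subst (_≤ sumRange i d bound-B) count≡n (ℕ.≤-trans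
    (countTrue≤length χ (λ v c → coeffs (d , v) ≈ₚ c) same-coeffs (allVecs q d) (allVecs-unique q d) (candidatesFrom i)
      (λ v _ χv → ∈-candidatesFrom i v k≤i (Equivalence.to (χ⇔ v) χv)))
    (length-candidatesFrom i))
    where
    same-coeffs : ∀ {v v′ c} → coeffs (d , v) ≈ₚ c → coeffs (d , v′) ≈ₚ c → v ≡ v′
    same-coeffs {v} {v′} v≈c v′≈c =
      ,-injectiveʳ-UIP ℕ.≡-irrelevant (coeffs-injective (d , v) (d , v′) (≈ₚ-trans v≈c (≈ₚ-sym v′≈c)))

-- The bound holds without using that q is a prime power, that d > 0, or that k ≤ e and λ_k > 0.
proposition4p4 : (q : ℕ) → IsPrimePower q → (F : FiniteField q) →
    (e d : ℕ) → e > d → d > 0 →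
    (g : Poly.Monic F) → Poly.deg F g ≡ e →
    (λs : ℕ → ℕ) → Poly.HasPattern F g λs →
    (k : ℕ) → 1 ≤ k → k ≤ e → λs k > 0 → (∀ i → 1 ≤ i → i < k → λs i ≡ 0) →
    (N : ℕ → ℕ) →
    (∀ i → k + 1 ≤ i → i ≤ d →
      HasCard {q} {d} (λ f → ∃[ j ] (i ≤ j × j ≤ d × Poly.DegGcd F g (d , f) j)) (N i)) →
    sumRange (k + 1) d N
      ≤ sumRange (k + 1) d (λ i → (i ∸ k) * (q ^ (d ∸ i)) * Tuples.innerSum λs k i)
proposition4p4 q _ F e d e>d _ g refl λs (ps , irreducible , g≡ , counts) k 1≤k _ _ λ<k≡0 N card = begin
  sumRange (k + 1) d N
    ≤⟨ sumRange-mono-≤ (k + 1) d (λ i k<i i≤d → union-card≤ i (ℕ.≤-trans (ℕ.m≤m+n k 1) k<i) (card i k<i i≤d)) ⟩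
  sumRange (k + 1) d (λ i → sumRange i d bound-B)
    ≡⟨ sumRange-triangle (k + 1) d bound-B ⟩
  sumRange (k + 1) d (λ j → (suc j ∸ (k + 1)) * bound-B j)
    ≡⟨ sumRange-cong (k + 1) d (λ j → trans (cong (λ k+1 → (suc j ∸ k+1) * bound-B j) (ℕ.+-comm k 1))
                                            (sym (ℕ.*-assoc (j ∸ k) (q ^ (d ∸ j)) _))) ⟩
  sumRange (k + 1) d (λ i → (i ∸ k) * (q ^ (d ∸ i)) * Tuples.innerSum λs k i) ∎
  where
  open ℕ.≤-Reasoning
  open RangeSums
  open GcdDegreeCount F g ps irreducible g≡ λs counts k 1≤k λ<k≡0 d (ℕ.<⇒≤ e>d)
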